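{- Let $d\ge1$, $r_1,\dots,r_d\ge1$, $w_i=z_{k_{i,1}}\cdots z_{k_{i,r_i}}$ ($i=1,\dots,d$) with positive integers $k_{i,j}$, $\boldsymbol{k}=[(k_{1,1},\dots,k_{1,r_1}),\dots,(k_{d,1},\dots,k_{d,r_d})]$, and fix $i$ with $1\le i\le d$. Then in $\mathcal{A}$, \begin{align*} &Z_{\mathcal{A}}^{\mathrm{cyc}}\bigl(w_{1}\otimes\cdots\otimes w_{i-1}\otimes(y\,\widetilde{\sqcup\!\sqcup}\, w_{i})\otimes w_{i+1}\otimes\cdots\otimes w_{d}\bigr)\\ &=\biggl(\sum_{j=1}^{r_i-1}\sum_{\substack{S_p\\ n_{i,j}<n<n_{i,j+1}}}\frac{1}{\boldsymbol{n}^{\boldsymbol{k}}}\Bigl(\frac{n_{i,j}}{n(n-n_{i,j})}-\frac{n_{i,j}^{k_{i,j}-1}}{n^{k_{i,j}-1}(n-n_{i,j})}\Bigr)\\ &\qquad+\sum_{\substack{S_p^{(i)}\\ n_{i,r_i}<n<p\\ n_{i-1,1}\le n<p}}\frac{1}{\boldsymbol{n}^{\boldsymbol{k}}}\Bigl(\frac{n_{i,r_i}}{n(n-n_{i,r_i})}-\frac{n_{i,r_i}^{k_{i,r_i}-1}}{n^{k_{i,r_i}-1}(n-n_{i,r_i})}\Bigr)\bmod p\biggr)_p, \end{align*} where in each sum the summation runs over tuples $(n_{1,1},\dots,n_{d,r_d})$ in the indicated set together with an additional integer $n$ satisfying the indicated inequalities.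
   Context: Let $\mathcal{A}=\bigl(\prod_p\mathbb{Z}/p\mathbb{Z}\bigr)/\bigl(\bigoplus_p\mathbb{Z}/p\mathbb{Z}\bigr)$ over all primes $p$. Let $\mathfrak{H}=\mathbb{Q}\langle x,y\rangle$, $z_k:=yx^{k-1}$. Shuffle product: $1\sqcup\!\sqcup w=w\sqcup\!\sqcup 1=w$, $wu\sqcup\!\sqcup w'u'=(w\sqcup\!\sqcup w'u')u+(wu\sqcup\!\sqcup w')u'$ for words $w,w'$, letters $u,u'$, extended bilinearly. Define $y\,\widetilde{\sqcup\!\sqcup}\, z_k:=-y^2$ ($k=1$), $0$ ($k=2$), $yx(y\sqcup\!\sqcup x^{k-3})x$ ($k\ge3$), and $y\,\widetilde{\sqcup\!\sqcup}\, z_{k_1}\cdots z_{k_r}:=\sum_{l=1}^r z_{k_1}\cdots z_{k_{l-1}}(y\,\widetilde{\sqcup\!\sqcup}\, z_{k_l})z_{k_{l+1}}\cdots z_{k_r}$. $\mathfrak{H}^{\mathrm{cyc}}$ is the span in $\bigoplus_{d\ge1}\mathfrak{H}^{\otimes d}$ of $w_1\otimes\cdots\otimes w_d$ with $w_i\in y\mathfrak{H}$. For $r=r_1+\cdots+r_d$ and a prime $p$, $S_p$ is the set of $(n_{1,1},\dots,n_{d,r_d})\in\{1,\dots,p-1\}^r$ with $n_{i,1}<\cdots<n_{i,r_i}$ for all $i$ and $n_{1,1}\le n_{2,r_2},\dots,n_{d-1,1}\le n_{d,r_d}$, $n_{d,1}\le n_{1,r_1}$. For $1\le i\le d$, $S_p^{(i)}$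 is the same set but omitting the single condition $n_{i-1,1}\le n_{i,r_i}$ (for $i=1$ this is the condition $n_{d,1}\le n_{1,r_1}$). Indices are cyclic: $n_{0,j}:=n_{d,j}$, $n_{d+1,j}:=n_{1,j}$; also $n_{i,r_i+1}:=p$. Write $\boldsymbol{n}^{\boldsymbol{k}}=\prod_{i=1}^d\prod_{j=1}^{r_i}n_{i,j}^{k_{i,j}}$. $\zeta^{\mathrm{cyc}}_{\mathcal{A}}(\boldsymbol{k})=\bigl(\sum_{S_p}1/\boldsymbol{n}^{\boldsymbol{k}}\bmod p\bigr)_p$, and $Z^{\mathrm{cyc}}_{\mathcal{A}}:\mathfrak{H}^{\mathrm{cyc}}\to\mathcal{A}$ is the $\mathbb{Q}$-linear map sending $z_{k_{1,1}}\cdots z_{k_{1,r_1}}\otimes\cdots\otimes z_{k_{d,1}}\cdots z_{k_{d,r_d}}$ to $\zeta^{\mathrm{cyc}}_{\mathcal{A}}([(k_{1,1},\dots,k_{1,r_1}),\dots,(k_{d,1},\dots,k_{d,r_d})])$. -}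

module Defs where

open import Data.Bool using (Bool; true; false; _∧_)
open import Relation.Nullary.Decidable using (T?)
open import Data.Bool.ListAction using (and)
open import Data.Nat as ℕ using (ℕ; zero; suc; _∸_; _^_; _≤ᵇ_; _<ᵇ_; _<_)
open import Data.Nat.Divisibility using (_∣_)
open import Data.Nat.Primality using (Prime)
open import Data.Integer as ℤ using (ℤ; +_; ∣_∣)
open import Data.Rational using (ℚ; 0ℚ; 1ℚ; _+_; _*_; _-_; -_; _/_; ↥_)
open import Data.List using (List; []; _∷_; _++_; map; concatMap; foldr; reverse; replicate; length; upTo; filter; zipWith; take; drop)
open import Data.Product using (_×_; _,_; proj₁; proj₂; ∃)

nth : {A : Set} → A → List A → ℕ → A
nth d []       _       = d
nth d (a ∷ as) zero    = a
nth d (a ∷ as) (suc m) = nth d as m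

headOr : {A : Set} → A → List A → A
headOr d []      = d
headOr d (a ∷ _) = a

lastOr : {A : Set} → A → List A → A
lastOr d []       = d
lastOr d (a ∷ as) = lastOr a as

removeNth : {A : Set} → ℕ → List A → List A
removeNth _       []       = []
removeNth zero    (a ∷ as) = as
removeNth (suc m) (a ∷ as) = a ∷ removeNth m as

-- cyclic right rotation: [B0,...,B_{d-1}] ↦ [B_{d-1},B0,...,B_{d-2}],
-- so position j holds the cyclic predecessor B_{j-1}
rotR : {A : Set} → List A → List A
rotR {A} bs = rot (reverse bs)
  where
  rot : List A → List A
  rot []       = []
  rot (l ∷ rs) = l ∷ reverse rs

sumℚ : List ℚ → ℚ
sumℚ = foldr _+_ 0ℚ

prodℚ : List ℚ → ℚ
prodℚ = foldr _*_ 1ℚ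

ℕtoℚ : ℕ → ℚ
ℕtoℚ n = (+ n) / 1

-- 1/n as a rational (convention 1/0 := 0; only used for n ≥ 1)
recip : ℕ → ℚ
recip zero    = 0ℚ
recip (suc m) = (+ 1) / suc m

-- The algebra 𝓐 = (∏_p Z/pZ)/(⊕_p Z/pZ).
-- An element is represented by a family of rationals indexed by p
-- (whose p-th component is read modulo p); two families are equal in 𝓐
-- iff they agree modulo p for all but finitely many primes p.

𝓐rep : Set
𝓐rep = ℕ → ℚ

_≡ℚ_[mod_] : ℚ → ℚ → ℕ → Set
a ≡ℚ b [mod p ] = p ∣ ∣ ↥ (a - b) ∣

_≈𝓐_ : 𝓐rep → 𝓐rep → Set
f ≈𝓐 g = ∃ λ (N : ℕ) → (p : ℕ) → Prime p → N < p → f p ≡ℚ g p [mod p ]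

data Letter : Set where
  x y : Letter

Word : Set
Word = List Letter

-- formal ℚ-linear combinations of words
Poly : Set
Poly = List (ℚ × Word)

z : ℕ → Word
z k = y ∷ replicate (k ∸ 1) x

zs : List ℕ → Word
zs = concatMap z

-- Shuffle product of words, following the paper's recursion on the LAST
-- letters: wu ш w'u' = (w ш w'u')u + (wu ш w')u'.  We work on reversed
-- words, so the last letter becomes the head.
shuffleRev : Word → Word → List Word
shuffleRev []       w'         = w' ∷ []
shuffleRev (u ∷ w)  []         = (u ∷ w) ∷ []
shuffleRev (u ∷ w)  (u' ∷ w')  =
  map (u ∷_) (shuffleRev w (u' ∷ w')) ++ map (u' ∷_) (shuffleRev (u ∷ w) w')

-- w ш w' as a list of words (each with coefficient 1, multiplicities kept)
shuffle : Word → Word → List Word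
shuffle w w' = map reverse (shuffleRev (reverse w) (reverse w'))

ytz : ℕ → Poly
ytz zero                = []   -- not used (k ≥ 1)
ytz (suc zero)          = (- 1ℚ , y ∷ y ∷ []) ∷ []
ytz (suc (suc zero))    = []
ytz k@(suc (suc (suc _))) =
  map (λ w → (1ℚ , y ∷ x ∷ (w ++ (x ∷ []))))
      (shuffle (y ∷ []) (replicate (k ∸ 3) x))

ytilde : List ℕ → Poly
ytilde ks = concatMap term (upTo (length ks))
  where
  term : ℕ → Poly
  term l = map (λ cw → (proj₁ cw , zs (take l ks) ++ (proj₂ cw ++ zs (drop (suc l) ks))))
               (ytz (nth 0 ks l))

-- 𝔥^cyc: formal ℚ-linear combinations of tensors w_1 ⊗ ⋯ ⊗ w_d
-- (a tensor is the list [w_1,…,w_d])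

TensorPoly : Set
TensorPoly = List (ℚ × List Word)

-- w_1 ⊗ ⋯ ⊗ w_{i-1} ⊗ P ⊗ w_{i+1} ⊗ ⋯ ⊗ w_d   (m = i-1 is 0-based)
insertAt : ℕ → List Word → Poly → TensorPoly
insertAt m ws P = map (λ cw → (proj₁ cw , take m ws ++ (proj₂ cw ∷ drop (suc m) ws))) P

-- a word y x^{a_1} y x^{a_2} ⋯ of y𝔥 ↦ its index list (a_1+1, a_2+1, …)
-- (leading x's, which do not occur for words of y𝔥, are discarded)
toIndices : Word → List ℕ
toIndices w = proj₂ (foldr step (0 , []) w)
  where
  step : Letter → ℕ × List ℕ → ℕ × List ℕ
  step x (c , ks) = (suc c , ks)
  step y (c , ks) = (0 , suc c ∷ ks)

vals : ℕ → List ℕ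
vals p = map suc (upTo (p ∸ 1))

seqs : ℕ → ℕ → List (List ℕ)
seqs p zero    = [] ∷ []
seqs p (suc r) = concatMap (λ v → map (v ∷_) (seqs p r)) (vals p)

tuples : ℕ → List (List ℕ) → List (List (List ℕ))
tuples p []       = [] ∷ []
tuples p (b ∷ bs) = concatMap (λ nb → map (nb ∷_) (tuples p bs)) (seqs p (length b))

strictIncr : List ℕ → Bool
strictIncr []            = true
strictIncr (a ∷ [])      = true
strictIncr (a ∷ b ∷ cs)  = (a <ᵇ b) ∧ strictIncr (b ∷ cs)

-- the d cyclic conditions; position j (0-based) is  n_{j-1,1} ≤ n_{j,r_j}
cycConds : List (List ℕ) → List Bool
cycConds nn = zipWith (λ prev cur → headOr 0 prev ≤ᵇ lastOr 0 cur) (rotR nn) nn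

inS : List (List ℕ) → Bool
inS nn = and (map strictIncr nn) ∧ and (cycConds nn)

-- S_p^{(i)}, with m = i-1 the 0-based index: omit condition n_{i-1,1} ≤ n_{i,r_i}
inS' : ℕ → List (List ℕ) → Bool
inS' m nn = and (map strictIncr nn) ∧ and (removeNth m (cycConds nn))

weight : List (List ℕ) → List (List ℕ) → ℚ
weight k nn = prodℚ (zipWith (λ kb nb → prodℚ (zipWith (λ kk n → recip (n ^ kk)) kb nb)) k nn)

sumS : ℕ → List (List ℕ) → (List (List ℕ) → ℚ) → ℚ
sumS p k f = sumℚ (map f (filter (λ nn → T? (inS nn)) (tuples p k)))

sumS' : ℕ → ℕ → List (List ℕ) → (List (List ℕ) → ℚ) → ℚ
sumS' p m k f = sumℚ (map f (filter (λ nn → T? (inS' m nn)) (tuples p k)))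

ζcyc : List (List ℕ) → ℕ → ℚ
ζcyc k p = sumS p k (weight k)

Zcyc : TensorPoly → 𝓐rep
Zcyc T p = sumℚ (map (λ cw → proj₁ cw * ζcyc (map toIndices (proj₂ cw)) p) T)

corr : ℕ → ℕ → ℕ → ℚ
corr a kk n = ℕtoℚ a * recip (n ℕ.* (n ∸ a))
            - ℕtoℚ (a ^ (kk ∸ 1)) * recip ((n ^ (kk ∸ 1)) ℕ.* (n ∸ a))

sumN : ℕ → (ℕ → Bool) → (ℕ → ℚ) → ℚ
sumN p P f = sumℚ (map f (filter (λ n → T? (P n)) (vals p)))

-- m = i-1 (0-based block index)
rhs : List (List ℕ) → ℕ → 𝓐rep
rhs k m p =
    sumS p k (λ nn →
      let b  = nth [] nn m
          kb = nth [] k m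
      in sumℚ (map (λ j →
            sumN p (λ n → (nth 0 b j <ᵇ n) ∧ (n <ᵇ nth 0 b (suc j)))
                   (λ n → weight k nn * corr (nth 0 b j) (nth 0 kb j) n))
           (upTo (length kb ∸ 1))))
  + sumS' p m k (λ nn →
      let b    = nth [] nn m
          kb   = nth [] k m
          prev = nth [] (rotR nn) m
      in sumN p (λ n → (lastOr 0 b <ᵇ n) ∧ (headOr 0 prev ≤ᵇ n))
                (λ n → weight k nn * corr (lastOr 0 b) (lastOr 0 kb) n))

-- The identity holds exactly in ℚ for every p, hence in 𝓐.  By the Leibniz rule y ~ш w_i is a
-- sum, over the positions l of w_i, of the terms of y ~ш z_K with K = k_(i,l), and y ~ш z_K is a
-- combination of words z_β z_γ: -z_1 z_1 for K = 1, nothing for K = 2 and the sum of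
-- z_(u+2) z_(v+2) over u + v = K - 3 for K ≥ 3.  Each term is a cyclic sum with one more variable
-- n, inserted right after a = n_(i,l); it replaces the factor 1/a^K of the weight by 1/(a^β n^γ),
-- and summed over the terms this is a^(-K) (a/(n(n-a)) - a^(K-1)/(n^(K-1)(n-a))), by repeated use
-- of 1/(a(n-a)) = 1/(an) + 1/(n(n-a)).  For l < r_i the new variable ranges over
-- n_(i,l) < n < n_(i,l+1).  For l = r_i it becomes the last variable of block i, so the cyclic
-- condition n_(i-1,1) ≤ n_(i,r_i) turns into n_(i,r_i) < n and n_(i-1,1) ≤ n, which leaves the
-- sum over S_p^(i).

module Submission where

open import Defs

open import Data.Bool using (Bool; true; false; _∧_; T; if_then_else_)
open import Data.Bool.ListAction using (and)
open import Data.Bool.Properties using (∧-commutativeMonoid; ∧-assoc; ∧-zeroʳ; ∧-identityʳ; T-∧)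
open import Data.Empty using (⊥-elim)
open import Function.Bundles using (Equivalence)
open import Algebra.Solver.CommutativeMonoid ∧-commutativeMonoid using (_⊕_; _⊜_) renaming (solve to ∧-solve)
open import Data.Nat as ℕ using (ℕ; zero; suc; _+_; _^_; _∸_; _≤_; _<_; z≤n; s≤s; _<ᵇ_; _≤ᵇ_)
import Data.Nat.Properties as ℕP
open import Data.Integer as ℤ using (+_)
import Data.Integer.Properties as ℤP
open import Data.Rational using (ℚ; 0ℚ; 1ℚ; _*_; _-_; -_; toℚᵘ; ↥_)
  renaming (_+_ to _+ℚ_)
open import Data.Rational.Properties
import Data.Rational.Unnormalised as U
import Data.Rational.Unnormalised.Properties as UP
open import Data.List
  using (List; []; _∷_; _++_; map; concatMap; foldr; filter; replicate; reverse; _∷ʳ_; take; drop; length; upTo; zipWith)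
import Data.List.Properties as LP
open import Data.List.Relation.Unary.All as All using (All; []; _∷_)
import Data.List.Relation.Unary.All.Properties as Allₚ
open import Data.Product using (_×_; _,_; proj₁; proj₂)
open import Relation.Nullary.Decidable using (T?)
open import Relation.Binary.PropositionalEquality
open import Function using (id)
open import Data.Nat.Divisibility using (_∣_; _∣0)
open import Data.Integer.Solver using () renaming (module +-*-Solver to ℤ-Solver)
open import Data.Rational.Solver using () renaming (module +-*-Solver to ℚ-Solver)

toℚᵘ-ℕtoℚ : ∀ n → toℚᵘ (ℕtoℚ n) U.≃ U.mkℚᵘ (+ n) 0
toℚᵘ-ℕtoℚ n = toℚᵘ-fromℚᵘ (U.mkℚᵘ (+ n) 0)

ℕtoℚ-+ : ∀ m n → ℕtoℚ (m + n) ≡ ℕtoℚ m +ℚ ℕtoℚ n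
ℕtoℚ-+ m n = toℚᵘ-injective (UP.≃-trans (toℚᵘ-ℕtoℚ (m + n)) (UP.≃-trans (U.*≡* eq)
  (UP.≃-sym (UP.≃-trans (toℚᵘ-homo-+ (ℕtoℚ m) (ℕtoℚ n)) (UP.+-cong (toℚᵘ-ℕtoℚ m) (toℚᵘ-ℕtoℚ n))))))
  where
  open ℤ-Solver
  eq : + (m + n) ℤ.* + 1 ≡ ((+ m ℤ.* + 1) ℤ.+ (+ n ℤ.* + 1)) ℤ.* + 1
  eq = trans (cong (ℤ._* + 1) (ℤP.pos-+ m n))
    (solve 2 (λ i j → (i :+ j) :* con (+ 1) := ((i :* con (+ 1)) :+ (j :* con (+ 1))) :* con (+ 1)) refl (+ m) (+ n))

ℕtoℚ-* : ∀ m n → ℕtoℚ (m ℕ.* n) ≡ ℕtoℚ m * ℕtoℚ n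
ℕtoℚ-* m n = toℚᵘ-injective (UP.≃-trans (toℚᵘ-ℕtoℚ (m ℕ.* n)) (UP.≃-trans (U.*≡* eq)
  (UP.≃-sym (UP.≃-trans (toℚᵘ-homo-* (ℕtoℚ m) (ℕtoℚ n)) (UP.*-cong (toℚᵘ-ℕtoℚ m) (toℚᵘ-ℕtoℚ n))))))
  where
  eq : + (m ℕ.* n) ℤ.* + 1 ≡ (+ m ℤ.* + n) ℤ.* + 1
  eq = cong (ℤ._* + 1) (ℤP.pos-* m n)

recip-inverseˡ : ∀ n .{{_ : ℕ.NonZero n}} → recip n * ℕtoℚ n ≡ 1ℚ
recip-inverseˡ (suc n) = toℚᵘ-injective (UP.≃-trans (toℚᵘ-homo-* (recip (suc n)) (ℕtoℚ (suc n)))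
  (UP.≃-trans (UP.*-cong (toℚᵘ-fromℚᵘ (U.mkℚᵘ (+ 1) n)) (toℚᵘ-ℕtoℚ (suc n))) (U.*≡* eq)))
  where
  open ℤ-Solver
  eq : (+ 1 ℤ.* + suc n) ℤ.* + 1 ≡ + 1 ℤ.* (+ suc n ℤ.* + 1)
  eq = solve 1 (λ i → (con (+ 1) :* i) :* con (+ 1) := con (+ 1) :* (i :* con (+ 1))) refl (+ suc n)

recip-unique : ∀ n q .{{_ : ℕ.NonZero n}} → q * ℕtoℚ n ≡ 1ℚ → q ≡ recip n
recip-unique n q qn≡1 = begin
  q                          ≡⟨ *-identityʳ q ⟨
  q * 1ℚ                     ≡⟨ cong (q *_) (recip-inverseˡ n) ⟨
  q * (recip n * ℕtoℚ n)     ≡⟨ cong (q *_) (*-comm (recip n) (ℕtoℚ n)) ⟩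
  q * (ℕtoℚ n * recip n)     ≡⟨ *-assoc q (ℕtoℚ n) (recip n) ⟨
  q * ℕtoℚ n * recip n       ≡⟨ cong (_* recip n) qn≡1 ⟩
  1ℚ * recip n               ≡⟨ *-identityˡ (recip n) ⟩
  recip n                    ∎
  where open ≡-Reasoning

recip-* : ∀ m n → recip (m ℕ.* n) ≡ recip m * recip n
recip-* zero    n       = sym (*-zeroˡ (recip n))
recip-* (suc m) zero    = trans (cong recip (ℕP.*-zeroʳ m)) (sym (*-zeroʳ (recip (suc m))))
recip-* m@(suc _) n@(suc _) = sym (recip-unique (m ℕ.* n) (recip m * recip n) (begin
  recip m * recip n * ℕtoℚ (m ℕ.* n)             ≡⟨ cong (recip m * recip n *_) (ℕtoℚ-* m n) ⟩
  recip m * recip n * (ℕtoℚ m * ℕtoℚ n)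
    ≡⟨ solve 4 (λ a b c d → a :* b :* (c :* d) := a :* c :* (b :* d)) refl (recip m) (recip n) (ℕtoℚ m) (ℕtoℚ n) ⟩
  recip m * ℕtoℚ m * (recip n * ℕtoℚ n)          ≡⟨ cong₂ _*_ (recip-inverseˡ m) (recip-inverseˡ n) ⟩
  1ℚ                                             ∎))
  where
  open ≡-Reasoning
  open ℚ-Solver

∑ : {A : Set} → List A → (A → ℚ) → ℚ
∑ xs f = sumℚ (map f xs)

module _ {A : Set} where

  ∑-cong : (xs : List A) {f g : A → ℚ} → (∀ a → f a ≡ g a) → ∑ xs f ≡ ∑ xs g
  ∑-cong []       f≗g = refl
  ∑-cong (a ∷ xs) f≗g = cong₂ _+ℚ_ (f≗g a) (∑-cong xs f≗g)

  ∑-congᴬ : {xs : List A} {f g : A → ℚ} → All (λ a → f a ≡ g a) xs → ∑ xs f ≡ ∑ xs g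
  ∑-congᴬ []         = refl
  ∑-congᴬ (e ∷ es)   = cong₂ _+ℚ_ e (∑-congᴬ es)

  ∑-zero : (xs : List A) → ∑ xs (λ _ → 0ℚ) ≡ 0ℚ
  ∑-zero []       = refl
  ∑-zero (a ∷ xs) = trans (+-identityˡ _) (∑-zero xs)

  ∑-++ : (xs ys : List A) (f : A → ℚ) → ∑ (xs ++ ys) f ≡ ∑ xs f +ℚ ∑ ys f
  ∑-++ []       ys f = sym (+-identityˡ _)
  ∑-++ (a ∷ xs) ys f = trans (cong (f a +ℚ_) (∑-++ xs ys f)) (sym (+-assoc (f a) _ _))

  ∑-+ : (xs : List A) (f g : A → ℚ) → ∑ xs (λ a → f a +ℚ g a) ≡ ∑ xs f +ℚ ∑ xs g
  ∑-+ []       f g = refl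
  ∑-+ (a ∷ xs) f g = trans (cong (f a +ℚ g a +ℚ_) (∑-+ xs f g))
    (solve 4 (λ u v s t → u :+ v :+ (s :+ t) := u :+ s :+ (v :+ t)) refl (f a) (g a) (∑ xs f) (∑ xs g))
    where open ℚ-Solver

  ∑-*ˡ : (xs : List A) (c : ℚ) (f : A → ℚ) → ∑ xs (λ a → c * f a) ≡ c * ∑ xs f
  ∑-*ˡ []       c f = sym (*-zeroʳ c)
  ∑-*ˡ (a ∷ xs) c f = trans (cong (c * f a +ℚ_) (∑-*ˡ xs c f)) (sym (*-distribˡ-+ c (f a) (∑ xs f)))

  ∑-filter : (P : A → Bool) (xs : List A) (f : A → ℚ) →
    sumℚ (map f (filter (λ a → T? (P a)) xs)) ≡ ∑ xs (λ a → if P a then f a else 0ℚ)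
  ∑-filter P []       f = refl
  ∑-filter P (a ∷ xs) f with P a
  ... | true  = cong (f a +ℚ_) (∑-filter P xs f)
  ... | false = trans (∑-filter P xs f) (sym (+-identityˡ _))

module _ {A B : Set} where

  ∑-map : (h : A → B) (xs : List A) (f : B → ℚ) → ∑ (map h xs) f ≡ ∑ xs (λ a → f (h a))
  ∑-map h []       f = refl
  ∑-map h (a ∷ xs) f = cong (f (h a) +ℚ_) (∑-map h xs f)

  ∑-concatMap : (h : A → List B) (xs : List A) (f : B → ℚ) → ∑ (concatMap h xs) f ≡ ∑ xs (λ a → ∑ (h a) f)
  ∑-concatMap h []       f = refl
  ∑-concatMap h (a ∷ xs) f = trans (∑-++ (h a) (concatMap h xs) f) (cong (∑ (h a) f +ℚ_) (∑-concatMap h xs f))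

  ∑-swap : (xs : List A) (ys : List B) (f : A → B → ℚ) → ∑ xs (λ a → ∑ ys (f a)) ≡ ∑ ys (λ b → ∑ xs (λ a → f a b))
  ∑-swap []       ys f = sym (∑-zero ys)
  ∑-swap (a ∷ xs) ys f = trans (cong (∑ ys (f a) +ℚ_) (∑-swap xs ys f)) (sym (∑-+ ys (f a) (λ b → ∑ xs (λ a → f a b))))

*-if : ∀ b c q → c * (if b then q else 0ℚ) ≡ (if b then c * q else 0ℚ)
*-if true  c q = refl
*-if false c q = *-zeroʳ c

∑-if : {A : Set} (b : Bool) (xs : List A) (f : A → ℚ) → ∑ xs (λ a → if b then f a else 0ℚ) ≡ (if b then ∑ xs f else 0ℚ)
∑-if true  xs f = refl
∑-if false xs f = ∑-zero xs

if-∧ : ∀ b c q → (if b then (if c then q else 0ℚ) else 0ℚ) ≡ (if b ∧ c then q else 0ℚ)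
if-∧ true  c q = refl
if-∧ false c q = refl

if-cong : ∀ b {q r} → (T b → q ≡ r) → (if b then q else 0ℚ) ≡ (if b then r else 0ℚ)
if-cong true  q≡r = q≡r _
if-cong false q≡r = refl

-- The terms of y ~ш z_K and their partial-fraction sum

recip-^1 : ∀ m → recip (m ^ 1) ≡ recip m
recip-^1 m = trans (recip-* m 1) (*-identityʳ (recip m))

recip-^2 : ∀ m → recip (m ^ 2) ≡ recip m * recip m
recip-^2 m = trans (recip-* m (m ^ 1)) (cong (recip m *_) (recip-^1 m))

-- the pairs (u , v) with u + v = j, in the order in which y ш x^j lists the words x^u y x^v
splits : ℕ → List (ℕ × ℕ)
splits zero    = (0 , 0) ∷ []
splits (suc j) = (suc j , 0) ∷ map (λ (u , v) → (u , suc v)) (splits j)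

module PartialFractions (a n : ℕ) .{{_ : ℕ.NonZero a}} (a<n : a < n) where

  open ≡-Reasoning
  open ℚ-Solver

  instance
    n≢0 : ℕ.NonZero n
    n≢0 = ℕ.>-nonZero (ℕP.<-≤-trans (ℕ.>-nonZero⁻¹ a) (ℕP.<⇒≤ a<n))
    n∸a≢0 : ℕ.NonZero (n ∸ a)
    n∸a≢0 = ℕ.>-nonZero (ℕP.m<n⇒0<n∸m a<n)

  α ν δ : ℚ
  α = recip a
  ν = recip n
  δ = recip (n ∸ a)

  α*δ : α * δ ≡ α * ν +ℚ ν * δ
  α*δ = begin
    α * δ                             ≡⟨ *-identityʳ (α * δ) ⟨
    α * δ * 1ℚ                        ≡⟨ cong (α * δ *_) (recip-inverseˡ n) ⟨
    α * δ * (ν * ℕtoℚ n)              ≡⟨ cong (λ m → α * δ * (ν * ℕtoℚ m)) (ℕP.m∸n+n≡m (ℕP.<⇒≤ a<n)) ⟨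
    α * δ * (ν * ℕtoℚ (n ∸ a + a))    ≡⟨ cong (λ q → α * δ * (ν * q)) (ℕtoℚ-+ (n ∸ a) a) ⟩
    α * δ * (ν * (D +ℚ A))
      ≡⟨ solve 5 (λ α δ ν D A → α :* δ :* (ν :* (D :+ A)) := α :* ν :* (δ :* D) :+ ν :* δ :* (α :* A)) refl α δ ν D A ⟩
    α * ν * (δ * D) +ℚ ν * δ * (α * A) ≡⟨ cong₂ (λ s t → α * ν * s +ℚ ν * δ * t) (recip-inverseˡ (n ∸ a)) (recip-inverseˡ a) ⟩
    α * ν * 1ℚ +ℚ ν * δ * 1ℚ          ≡⟨ cong₂ _+ℚ_ (*-identityʳ (α * ν)) (*-identityʳ (ν * δ)) ⟩
    α * ν +ℚ ν * δ                    ∎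
    where
    A D : ℚ
    A = ℕtoℚ a
    D = ℕtoℚ (n ∸ a)

  corrTerm : ℕ → ℚ
  corrTerm j = recip (a ^ j) * (ν * δ) - α * (recip (n ^ j) * δ)

  scaled-corr : ∀ j → recip (a ^ suc j) * corr a (suc j) n ≡ corrTerm j
  scaled-corr j = begin
    recip (a ^ suc j) * corr a (suc j) n
      ≡⟨ cong₂ (λ s t → s * (A * t - P * recip (n ^ j ℕ.* (n ∸ a)))) (recip-* a (a ^ j)) (recip-* n (n ∸ a)) ⟩
    α * R * (A * (ν * δ) - P * recip (n ^ j ℕ.* (n ∸ a)))
      ≡⟨ cong (λ t → α * R * (A * (ν * δ) - P * t)) (recip-* (n ^ j) (n ∸ a)) ⟩
    α * R * (A * (ν * δ) - P * (N * δ))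
      ≡⟨ solve 7 (λ α R A P N ν δ → α :* R :* (A :* (ν :* δ) :- P :* (N :* δ))
                                    := α :* A :* (R :* (ν :* δ)) :- α :* (R :* P :* (N :* δ))) refl α R A P N ν δ ⟩
    α * A * (R * (ν * δ)) - α * (R * P * (N * δ))
      ≡⟨ cong₂ (λ s t → s * (R * (ν * δ)) - α * (t * (N * δ))) (recip-inverseˡ a) (recip-inverseˡ (a ^ j) {{ℕP.m^n≢0 a j}}) ⟩
    1ℚ * (R * (ν * δ)) - α * (1ℚ * (N * δ))
      ≡⟨ cong₂ (λ s t → s - α * t) (*-identityˡ (R * (ν * δ))) (*-identityˡ (N * δ)) ⟩
    corrTerm j ∎
    where
    A P R N : ℚ
    A = ℕtoℚ a
    P = ℕtoℚ (a ^ j)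
    R = recip (a ^ j)
    N = recip (n ^ j)

  ∑-splits : ∀ j → ∑ (splits j) (λ (u , v) → recip (a ^ (2 + u)) * recip (n ^ (2 + v))) ≡ corrTerm (2 + j)
  ∑-splits zero = begin
    recip (a ^ 2) * recip (n ^ 2) +ℚ 0ℚ
      ≡⟨ cong₂ (λ s t → s * t +ℚ 0ℚ) (recip-^2 a) (recip-^2 n) ⟩
    α * α * (ν * ν) +ℚ 0ℚ
      ≡⟨ solve 3 (λ α ν δ → α :* α :* (ν :* ν) :+ con 0ℚ := α :* ν :* (α :* ν :+ ν :* δ) :- α :* ν :* (ν :* δ)) refl α ν δ ⟩
    α * ν * (α * ν +ℚ ν * δ) - α * ν * (ν * δ)
      ≡⟨ cong (λ t → α * ν * t - α * ν * (ν * δ)) α*δ ⟨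
    α * ν * (α * δ) - α * ν * (ν * δ)
      ≡⟨ solve 3 (λ α ν δ → α :* ν :* (α :* δ) :- α :* ν :* (ν :* δ) := α :* α :* (ν :* δ) :- α :* (ν :* ν :* δ)) refl α ν δ ⟩
    α * α * (ν * δ) - α * (ν * ν * δ)
      ≡⟨ cong₂ (λ s t → s * (ν * δ) - α * (t * δ)) (recip-^2 a) (recip-^2 n) ⟨
    corrTerm 2 ∎
  ∑-splits (suc j) = begin
    Rₐ′ * recip (n ^ 2) +ℚ ∑ (map (λ (u , v) → (u , suc v)) (splits j)) f
      ≡⟨ cong₂ _+ℚ_ (cong₂ _*_ (recip-* a (a ^ (2 + j))) (recip-^2 n)) (∑-map _ (splits j) f) ⟩
    α * Rₐ * (ν * ν) +ℚ ∑ (splits j) (λ (u , v) → recip (a ^ (2 + u)) * recip (n ℕ.* n ^ (2 + v)))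
      ≡⟨ cong (α * Rₐ * (ν * ν) +ℚ_) (∑-cong (splits j) (λ (u , v) → peel-ν (recip (a ^ (2 + u))) (2 + v))) ⟩
    α * Rₐ * (ν * ν) +ℚ ∑ (splits j) (λ (u , v) → ν * (recip (a ^ (2 + u)) * recip (n ^ (2 + v))))
      ≡⟨ cong (α * Rₐ * (ν * ν) +ℚ_) (trans (∑-*ˡ (splits j) ν _) (cong (ν *_) (∑-splits j))) ⟩
    α * Rₐ * (ν * ν) +ℚ ν * (Rₐ * (ν * δ) - α * (Rₙ * δ))
      ≡⟨ solve 5 (λ α ν δ Rₐ Rₙ → α :* Rₐ :* (ν :* ν) :+ ν :* (Rₐ :* (ν :* δ) :- α :* (Rₙ :* δ))
                                   := Rₐ :* ν :* (α :* ν :+ ν :* δ) :- α :* (ν :* Rₙ :* δ)) refl α ν δ Rₐ Rₙ ⟩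
    Rₐ * ν * (α * ν +ℚ ν * δ) - α * (ν * Rₙ * δ)
      ≡⟨ cong (λ t → Rₐ * ν * t - α * (ν * Rₙ * δ)) α*δ ⟨
    Rₐ * ν * (α * δ) - α * (ν * Rₙ * δ)
      ≡⟨ solve 5 (λ α ν δ Rₐ Rₙ → Rₐ :* ν :* (α :* δ) :- α :* (ν :* Rₙ :* δ)
                                   := α :* Rₐ :* (ν :* δ) :- α :* (ν :* Rₙ :* δ)) refl α ν δ Rₐ Rₙ ⟩
    α * Rₐ * (ν * δ) - α * (ν * Rₙ * δ)
      ≡⟨ cong₂ (λ s t → s * (ν * δ) - α * (t * δ)) (recip-* a (a ^ (2 + j))) (recip-* n (n ^ (2 + j))) ⟨
    corrTerm (3 + j) ∎
    where
    f : ℕ × ℕ → ℚ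
    f (u , v) = recip (a ^ (2 + u)) * recip (n ^ (2 + v))
    Rₐ Rₐ′ Rₙ : ℚ
    Rₐ = recip (a ^ (2 + j))
    Rₐ′ = recip (a ^ (3 + j))
    Rₙ = recip (n ^ (2 + j))
    peel-ν : ∀ q e → q * recip (n ℕ.* n ^ e) ≡ ν * (q * recip (n ^ e))
    peel-ν q e = trans (cong (q *_) (recip-* n (n ^ e)))
      (solve 3 (λ q ν r → q :* (ν :* r) := ν :* (q :* r)) refl q ν (recip (n ^ e)))

-- y ~ш z_K as a list of terms (c , β , γ) standing for c · z_β z_γ
shuffleTerms : ℕ → List (ℚ × ℕ × ℕ)
shuffleTerms 1                   = (- 1ℚ , 1 , 1) ∷ []
shuffleTerms (suc (suc (suc j))) = map (λ (u , v) → (1ℚ , 2 + u , 2 + v)) (splits j)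
shuffleTerms _                   = []

shuffleTerms-positive : ∀ K → All (λ (_ , β , γ) → 1 ≤ β × 1 ≤ γ) (shuffleTerms K)
shuffleTerms-positive 0                   = []
shuffleTerms-positive 1                   = (s≤s z≤n , s≤s z≤n) ∷ []
shuffleTerms-positive 2                   = []
shuffleTerms-positive (suc (suc (suc j))) = Allₚ.map⁺ (All.universal (λ _ → s≤s z≤n , s≤s z≤n) (splits j))

termWeight : ℕ → ℕ → ℚ × ℕ × ℕ → ℚ
termWeight a n (c , β , γ) = c * (recip (a ^ β) * recip (n ^ γ))

∑-shuffleTerms : ∀ a n K → a < n → 1 ≤ K → ∑ (shuffleTerms K) (termWeight a n) ≡ recip (a ^ K) * corr a K n
∑-shuffleTerms zero n (suc K) _ _ = begin
  ∑ (shuffleTerms (suc K)) (termWeight 0 n)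
    ≡⟨ ∑-congᴬ (All.map (λ {t} (β≥1 , _) → vanish t β≥1) (shuffleTerms-positive (suc K))) ⟩
  ∑ (shuffleTerms (suc K)) (λ _ → 0ℚ)
    ≡⟨ ∑-zero (shuffleTerms (suc K)) ⟩
  0ℚ
    ≡⟨ *-zeroˡ (corr 0 (suc K) n) ⟨
  recip (0 ^ suc K) * corr 0 (suc K) n ∎
  where
  open ≡-Reasoning
  -- recip 0 = 0, so for a = 0 both sides vanish.
  vanish : ∀ t → 1 ≤ proj₁ (proj₂ t) → termWeight 0 n t ≡ 0ℚ
  vanish (c , suc β , γ) _ = trans (cong (c *_) (*-zeroˡ (recip (n ^ γ)))) (*-zeroʳ c)
∑-shuffleTerms a@(suc _) n 1 a<n _ = begin
  - 1ℚ * (recip (a ^ 1) * recip (n ^ 1)) +ℚ 0ℚ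
    ≡⟨ cong (λ t → - 1ℚ * t +ℚ 0ℚ) (cong₂ _*_ (recip-^1 a) (recip-^1 n)) ⟩
  - 1ℚ * (α * ν) +ℚ 0ℚ
    ≡⟨ solve 3 (λ α ν δ → con (- 1ℚ) :* (α :* ν) :+ con 0ℚ := ν :* δ :- (α :* ν :+ ν :* δ)) refl α ν δ ⟩
  ν * δ - (α * ν +ℚ ν * δ)
    ≡⟨ cong (λ t → ν * δ - t) α*δ ⟨
  ν * δ - α * δ
    ≡⟨ solve 3 (λ α ν δ → ν :* δ :- α :* δ := con 1ℚ :* (ν :* δ) :- α :* (con 1ℚ :* δ)) refl α ν δ ⟩
  corrTerm 0
    ≡⟨ scaled-corr 0 ⟨
  recip (a ^ 1) * corr a 1 n ∎
  where
  open ≡-Reasoning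
  open ℚ-Solver
  open PartialFractions a n a<n
∑-shuffleTerms a@(suc _) n 2 a<n _ = sym (trans (scaled-corr 1) (begin
  recip (a ^ 1) * (ν * δ) - α * (recip (n ^ 1) * δ) ≡⟨ cong₂ (λ s t → s * (ν * δ) - α * (t * δ)) (recip-^1 a) (recip-^1 n) ⟩
  α * (ν * δ) - α * (ν * δ)                          ≡⟨ +-inverseʳ (α * (ν * δ)) ⟩
  0ℚ                                                 ∎))
  where
  open ≡-Reasoning
  open PartialFractions a n a<n
∑-shuffleTerms a@(suc _) n (suc (suc (suc j))) a<n _ = begin
  ∑ (map (λ (u , v) → (1ℚ , 2 + u , 2 + v)) (splits j)) (termWeight a n)
    ≡⟨ ∑-map _ (splits j) (termWeight a n) ⟩
  ∑ (splits j) (λ (u , v) → 1ℚ * (recip (a ^ (2 + u)) * recip (n ^ (2 + v))))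
    ≡⟨ ∑-cong (splits j) (λ _ → *-identityˡ _) ⟩
  ∑ (splits j) (λ (u , v) → recip (a ^ (2 + u)) * recip (n ^ (2 + v)))
    ≡⟨ ∑-splits j ⟩
  corrTerm (2 + j)
    ≡⟨ scaled-corr (2 + j) ⟨
  recip (a ^ (3 + j)) * corr a (3 + j) n ∎
  where
  open ≡-Reasoning
  open PartialFractions a n a<n

module _ {A : Set} (a : A) where

  replicate-∷ʳ : ∀ n → replicate n a ∷ʳ a ≡ a ∷ replicate n a
  replicate-∷ʳ zero    = refl
  replicate-∷ʳ (suc n) = cong (a ∷_) (replicate-∷ʳ n)

  reverse-replicate : ∀ n → reverse (replicate n a) ≡ replicate n a
  reverse-replicate zero    = refl
  reverse-replicate (suc n) = begin
    reverse (a ∷ replicate n a)     ≡⟨ LP.unfold-reverse a (replicate n a) ⟩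
    reverse (replicate n a) ∷ʳ a    ≡⟨ cong (_∷ʳ a) (reverse-replicate n) ⟩
    replicate n a ∷ʳ a              ≡⟨ replicate-∷ʳ n ⟩
    a ∷ replicate n a               ∎
    where open ≡-Reasoning

shuffleRev-y-xⁿ : ∀ j → shuffleRev (y ∷ []) (replicate j x) ≡ map (λ (u , v) → replicate v x ++ y ∷ replicate u x) (splits j)
shuffleRev-y-xⁿ zero    = refl
shuffleRev-y-xⁿ (suc j) = cong ((y ∷ x ∷ replicate j x) ∷_) (begin
  map (x ∷_) (shuffleRev (y ∷ []) (replicate j x))                        ≡⟨ cong (map (x ∷_)) (shuffleRev-y-xⁿ j) ⟩
  map (x ∷_) (map (λ (u , v) → replicate v x ++ y ∷ replicate u x) (splits j)) ≡⟨ LP.map-∘ (splits j) ⟨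
  map (λ (u , v) → replicate (suc v) x ++ y ∷ replicate u x) (splits j)     ≡⟨ LP.map-∘ (splits j) ⟩
  map (λ (u , v) → replicate v x ++ y ∷ replicate u x) (map (λ (u , v) → (u , suc v)) (splits j)) ∎)
  where open ≡-Reasoning

shuffle-y-xⁿ : ∀ j → shuffle (y ∷ []) (replicate j x) ≡ map (λ (u , v) → replicate u x ++ y ∷ replicate v x) (splits j)
shuffle-y-xⁿ j = begin
  map reverse (shuffleRev (y ∷ []) (reverse (replicate j x)))
    ≡⟨ cong (λ w → map reverse (shuffleRev (y ∷ []) w)) (reverse-replicate x j) ⟩
  map reverse (shuffleRev (y ∷ []) (replicate j x))
    ≡⟨ cong (map reverse) (shuffleRev-y-xⁿ j) ⟩
  map reverse (map (λ (u , v) → replicate v x ++ y ∷ replicate u x) (splits j))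
    ≡⟨ LP.map-∘ (splits j) ⟨
  map (λ (u , v) → reverse (replicate v x ++ y ∷ replicate u x)) (splits j)
    ≡⟨ LP.map-cong reverse-word (splits j) ⟩
  map (λ (u , v) → replicate u x ++ y ∷ replicate v x) (splits j) ∎
  where
  open ≡-Reasoning
  reverse-word : ∀ ((u , v) : ℕ × ℕ) → reverse (replicate v x ++ y ∷ replicate u x) ≡ replicate u x ++ y ∷ replicate v x
  reverse-word (u , v) = begin
    reverse (replicate v x ++ y ∷ replicate u x)
      ≡⟨ LP.reverse-++ (replicate v x) (y ∷ replicate u x) ⟩
    reverse (y ∷ replicate u x) ++ reverse (replicate v x)
      ≡⟨ cong₂ _++_ (LP.unfold-reverse y (replicate u x)) (reverse-replicate x v) ⟩
    (reverse (replicate u x) ∷ʳ y) ++ replicate v x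
      ≡⟨ cong (λ w → (w ∷ʳ y) ++ replicate v x) (reverse-replicate x u) ⟩
    (replicate u x ∷ʳ y) ++ replicate v x
      ≡⟨ LP.++-assoc (replicate u x) (y ∷ []) (replicate v x) ⟩
    replicate u x ++ y ∷ replicate v x ∎

termWord : ℚ × ℕ × ℕ → ℚ × Word
termWord (c , β , γ) = (c , zs (β ∷ γ ∷ []))

ytz-shuffleTerms : ∀ K → ytz K ≡ map termWord (shuffleTerms K)
ytz-shuffleTerms 0                   = refl
ytz-shuffleTerms 1                   = refl
ytz-shuffleTerms 2                   = refl
ytz-shuffleTerms (suc (suc (suc j))) = begin
  map wrap (shuffle (y ∷ []) (replicate j x))                                  ≡⟨ cong (map wrap) (shuffle-y-xⁿ j) ⟩
  map wrap (map (λ (u , v) → replicate u x ++ y ∷ replicate v x) (splits j))   ≡⟨ LP.map-∘ (splits j) ⟨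
  map (λ (u , v) → wrap (replicate u x ++ y ∷ replicate v x)) (splits j)       ≡⟨ LP.map-cong wrap-word (splits j) ⟩
  map (λ (u , v) → termWord (1ℚ , 2 + u , 2 + v)) (splits j)                    ≡⟨ LP.map-∘ (splits j) ⟩
  map termWord (shuffleTerms (3 + j))                                          ∎
  where
  open ≡-Reasoning
  wrap : Word → ℚ × Word
  wrap w = (1ℚ , y ∷ x ∷ (w ++ x ∷ []))
  wrap-word : ∀ ((u , v) : ℕ × ℕ) → wrap (replicate u x ++ y ∷ replicate v x) ≡ termWord (1ℚ , 2 + u , 2 + v)
  wrap-word (u , v) = cong (λ w → (1ℚ , y ∷ x ∷ w)) (begin
    (replicate u x ++ y ∷ replicate v x) ++ x ∷ []
      ≡⟨ LP.++-assoc (replicate u x) (y ∷ replicate v x) (x ∷ []) ⟩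
    replicate u x ++ y ∷ (replicate v x ∷ʳ x)
      ≡⟨ cong (λ w → replicate u x ++ y ∷ w) (replicate-∷ʳ x v) ⟩
    replicate u x ++ y ∷ x ∷ replicate v x
      ≡⟨ cong (λ w → replicate u x ++ y ∷ x ∷ w) (LP.++-identityʳ (replicate v x)) ⟨
    replicate u x ++ y ∷ x ∷ replicate v x ++ [] ∎)

leadingXs : Word → ℕ
leadingXs (x ∷ w) = suc (leadingXs w)
leadingXs _       = 0

-- `toIndices` folds a step function local to its definition; this lemma is stated for every
-- step function with the relevant equations, and unification supplies that one.
foldr-leadingXs : (step : Letter → ℕ × List ℕ → ℕ × List ℕ) →
  (∀ s → proj₁ (step x s) ≡ suc (proj₁ s)) → (∀ s → proj₁ (step y s) ≡ 0) →
  ∀ w → proj₁ (foldr step (0 , []) w) ≡ leadingXs w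
foldr-leadingXs step step-x step-y []      = refl
foldr-leadingXs step step-x step-y (x ∷ w) = trans (step-x _) (cong suc (foldr-leadingXs step step-x step-y w))
foldr-leadingXs step step-x step-y (y ∷ w) = step-y _

toIndices-y∷ : ∀ w → toIndices (y ∷ w) ≡ suc (leadingXs w) ∷ toIndices w
toIndices-y∷ w = cong (λ c → suc c ∷ toIndices w) (foldr-leadingXs _ (λ _ → refl) (λ _ → refl) w)

toIndices-xⁿ++ : ∀ j w → toIndices (replicate j x ++ w) ≡ toIndices w
toIndices-xⁿ++ zero    w = refl
toIndices-xⁿ++ (suc j) w = toIndices-xⁿ++ j w

leadingXs-xⁿ++ : ∀ j w → leadingXs (replicate j x ++ w) ≡ j + leadingXs w
leadingXs-xⁿ++ zero    w = refl
leadingXs-xⁿ++ (suc j) w = cong suc (leadingXs-xⁿ++ j w)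

leadingXs-zs : ∀ ks → leadingXs (zs ks) ≡ 0
leadingXs-zs []      = refl
leadingXs-zs (_ ∷ _) = refl

toIndices-zs : ∀ {ks} → All (1 ≤_) ks → toIndices (zs ks) ≡ ks
toIndices-zs {[]}    []       = refl
toIndices-zs {suc k ∷ ks} (_ ∷ ks-pos) = begin
  toIndices (y ∷ replicate k x ++ zs ks)
    ≡⟨ toIndices-y∷ (replicate k x ++ zs ks) ⟩
  suc (leadingXs (replicate k x ++ zs ks)) ∷ toIndices (replicate k x ++ zs ks)
    ≡⟨ cong₂ (λ c is → suc c ∷ is) count (toIndices-xⁿ++ k (zs ks)) ⟩
  suc k ∷ toIndices (zs ks)
    ≡⟨ cong (suc k ∷_) (toIndices-zs ks-pos) ⟩
  suc k ∷ ks ∎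
  where
  open ≡-Reasoning
  count : leadingXs (replicate k x ++ zs ks) ≡ k
  count = trans (leadingXs-xⁿ++ k (zs ks)) (trans (cong (λ c → k + c) (leadingXs-zs ks)) (ℕP.+-identityʳ k))

expandAt : ℕ → ℕ → ℕ → List ℕ → List ℕ
expandAt l β γ kb = take l kb ++ β ∷ γ ∷ drop (suc l) kb

toIndices-expandAt : ∀ l {β γ kb} → 1 ≤ β → 1 ≤ γ → All (1 ≤_) kb →
  toIndices (zs (take l kb) ++ (zs (β ∷ γ ∷ []) ++ zs (drop (suc l) kb))) ≡ expandAt l β γ kb
toIndices-expandAt l {β} {γ} {kb} β≥1 γ≥1 kb-pos = begin
  toIndices (zs (take l kb) ++ (zs (β ∷ γ ∷ []) ++ zs (drop (suc l) kb)))
    ≡⟨ cong (λ w → toIndices (zs (take l kb) ++ w)) (LP.concatMap-++ z (β ∷ γ ∷ []) (drop (suc l) kb)) ⟨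
  toIndices (zs (take l kb) ++ zs (β ∷ γ ∷ drop (suc l) kb))
    ≡⟨ cong toIndices (LP.concatMap-++ z (take l kb) (β ∷ γ ∷ drop (suc l) kb)) ⟨
  toIndices (zs (expandAt l β γ kb))
    ≡⟨ toIndices-zs (Allₚ.++⁺ (Allₚ.take⁺ l kb-pos) (β≥1 ∷ γ≥1 ∷ Allₚ.drop⁺ (suc l) kb-pos)) ⟩
  expandAt l β γ kb ∎
  where open ≡-Reasoning

replaceAt : {A : Set} → ℕ → A → List A → List A
replaceAt m v xs = take m xs ++ v ∷ drop (suc m) xs

insertInto : {A : Set} → ℕ → A → List A → List A
insertInto l v xs = take l xs ++ v ∷ drop l xs

All-nth : {A : Set} {P : A → Set} (d : A) {xs : List A} → All P xs → ∀ m → m < length xs → P (nth d xs m)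
All-nth d (px ∷ _)   zero    _         = px
All-nth d (_  ∷ pxs) (suc m) (s≤s m<n) = All-nth d pxs m m<n

rotHead : {A : Set} → List A → List A
rotHead []       = []
rotHead (a ∷ xs) = a ∷ reverse xs

-- rotR is rotHead ∘ reverse, written with a helper local to its definition
rotR-reverse : {A : Set} (xs : List A) → rotR xs ≡ rotHead (reverse xs)
rotR-reverse xs with reverse xs
... | []     = refl
... | _ ∷ _  = refl

length-rotR : {A : Set} (xs : List A) → length (rotR xs) ≡ length xs
length-rotR xs = trans (cong length (rotR-reverse xs)) (trans (length-rotHead (reverse xs)) (LP.length-reverse xs))
  where
  length-rotHead : ∀ {A : Set} (ws : List A) → length (rotHead ws) ≡ length ws
  length-rotHead []       = refl
  length-rotHead (w ∷ ws) = cong suc (LP.length-reverse ws)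

module _ {A : Set} where

  replaceAt-nth : ∀ (d : A) m xs → m < length xs → replaceAt m (nth d xs m) xs ≡ xs
  replaceAt-nth d zero    (a ∷ xs) _         = refl
  replaceAt-nth d (suc m) (a ∷ xs) (s≤s m<n) = cong (a ∷_) (replaceAt-nth d m xs m<n)

  insertInto-length : ∀ (v : A) xs → insertInto (length xs) v xs ≡ xs ∷ʳ v
  insertInto-length v []       = refl
  insertInto-length v (a ∷ xs) = cong (a ∷_) (insertInto-length v xs)

  lastOr-∷ʳ : ∀ (d v : A) xs → lastOr d (xs ∷ʳ v) ≡ v
  lastOr-∷ʳ d v []       = refl
  lastOr-∷ʳ d v (a ∷ xs) = lastOr-∷ʳ a v xs

  nth-lastIndex : ∀ (d : A) xs → 1 ≤ length xs → nth d xs (length xs ∸ 1) ≡ lastOr d xs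
  nth-lastIndex d (a ∷ [])     _ = refl
  nth-lastIndex d (a ∷ b ∷ xs) _ = nth-lastIndex d (b ∷ xs) (s≤s z≤n)

  headOr-insertInto : ∀ (d v : A) j xs → 1 ≤ length xs → headOr d (insertInto (suc j) v xs) ≡ headOr d xs
  headOr-insertInto d v j (a ∷ xs) _ = refl

  lastOr-insertInto : ∀ (d v : A) j xs → suc j < length xs → lastOr d (insertInto (suc j) v xs) ≡ lastOr d xs
  lastOr-insertInto d v zero    (a ∷ [])     (s≤s ())
  lastOr-insertInto d v zero    (a ∷ b ∷ xs) _          = refl
  lastOr-insertInto d v (suc j) (a ∷ b ∷ xs) (s≤s j<n)  = lastOr-insertInto a v j (b ∷ xs) j<n

module _ {A B : Set} (f : A → B) where

  nth-map : ∀ (d : A) (d′ : B) m xs → m < length xs → nth d′ (map f xs) m ≡ f (nth d xs m)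
  nth-map d d′ zero    (a ∷ xs) _         = refl
  nth-map d d′ (suc m) (a ∷ xs) (s≤s m<n) = nth-map d d′ m xs m<n

  map-replaceAt : ∀ m v xs → map f (replaceAt m v xs) ≡ replaceAt m (f v) (map f xs)
  map-replaceAt zero    v []       = refl
  map-replaceAt zero    v (a ∷ xs) = refl
  map-replaceAt (suc m) v []       = refl
  map-replaceAt (suc m) v (a ∷ xs) = cong (f a ∷_) (map-replaceAt m v xs)

  map-replaceAt-same : ∀ d m v xs → m < length xs → f v ≡ f (nth d xs m) → map f (replaceAt m v xs) ≡ map f xs
  map-replaceAt-same d m v xs m<n fv≡ = begin
    map f (replaceAt m v xs)
      ≡⟨ map-replaceAt m v xs ⟩
    replaceAt m (f v) (map f xs)
      ≡⟨ cong (λ w → replaceAt m w (map f xs)) (trans fv≡ (sym (nth-map d (f d) m xs m<n))) ⟩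
    replaceAt m (nth (f d) (map f xs) m) (map f xs)
      ≡⟨ replaceAt-nth (f d) m (map f xs) (subst (m <_) (sym (LP.length-map f xs)) m<n) ⟩
    map f xs ∎
    where open ≡-Reasoning

  map-rotR : ∀ xs → map f (rotR xs) ≡ rotR (map f xs)
  map-rotR xs = begin
    map f (rotR xs)                ≡⟨ cong (map f) (rotR-reverse xs) ⟩
    map f (rotHead (reverse xs))   ≡⟨ map-rotHead (reverse xs) ⟩
    rotHead (map f (reverse xs))   ≡⟨ cong rotHead (LP.reverse-map f xs) ⟩
    rotHead (reverse (map f xs))   ≡⟨ rotR-reverse (map f xs) ⟨
    rotR (map f xs)                ∎
    where
    open ≡-Reasoning
    map-rotHead : ∀ ws → map f (rotHead ws) ≡ rotHead (map f ws)
    map-rotHead []       = refl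
    map-rotHead (w ∷ ws) = cong (f w ∷_) (LP.reverse-map f ws)

module _ {A : Set} (f : A → Bool) where

  and-map-replaceAt : ∀ m v xs → m < length xs → and (map f (replaceAt m v xs)) ≡ f v ∧ and (removeNth m (map f xs))
  and-map-replaceAt zero    v (a ∷ xs) _         = refl
  and-map-replaceAt (suc m) v (a ∷ xs) (s≤s m<n) =
    trans (cong (f a ∧_) (and-map-replaceAt m v xs m<n)) (∧-solve 3 (λ a v r → a ⊕ (v ⊕ r) ⊜ v ⊕ (a ⊕ r)) refl (f a) (f v) _)

  and-map-nth : ∀ d m xs → m < length xs → and (map f xs) ≡ f (nth d xs m) ∧ and (removeNth m (map f xs))
  and-map-nth d m xs m<n =
    trans (cong (λ ws → and (map f ws)) (sym (replaceAt-nth d m xs m<n))) (and-map-replaceAt m (nth d xs m) xs m<n)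

and-zipWith-replaceAt : {A B : Set} (g : A → B → Bool) (d : A) (m : ℕ) (v : B) (xs : List A) (ys : List B) →
  m < length xs → m < length ys →
  and (zipWith g xs (replaceAt m v ys)) ≡ g (nth d xs m) v ∧ and (removeNth m (zipWith g xs ys))
and-zipWith-replaceAt g d zero    v (a ∷ xs) (b ∷ ys) _ _ = refl
and-zipWith-replaceAt g d (suc m) v (a ∷ xs) (b ∷ ys) (s≤s m<xs) (s≤s m<ys) =
  trans (cong (g a b ∧_) (and-zipWith-replaceAt g d m v xs ys m<xs m<ys))
        (∧-solve 3 (λ a v r → a ⊕ (v ⊕ r) ⊜ v ⊕ (a ⊕ r)) refl (g a b) (g (nth d xs m) v) _)

zipWith-map : {A B A′ B′ C : Set} (g : A′ → B′ → C) (f : A → A′) (h : B → B′) (xs : List A) (ys : List B) →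
  zipWith (λ a b → g (f a) (h b)) xs ys ≡ zipWith g (map f xs) (map h ys)
zipWith-map g f h []       ys       = refl
zipWith-map g f h (a ∷ xs) []       = refl
zipWith-map g f h (a ∷ xs) (b ∷ ys) = cong (g (f a) (h b) ∷_) (zipWith-map g f h xs ys)

module _ {A B : Set} (g : A → B → ℚ) where

  prodℚ-zipWith-replaceAt : ∀ m u v xs ys → m < length xs → length xs ≡ length ys →
    prodℚ (zipWith g (replaceAt m u xs) (replaceAt m v ys)) ≡ prodℚ (zipWith g (removeNth m xs) (removeNth m ys)) * g u v
  prodℚ-zipWith-replaceAt zero    u v (a ∷ xs) (b ∷ ys) _         _  = *-comm (g u v) _
  prodℚ-zipWith-replaceAt (suc m) u v (a ∷ xs) (b ∷ ys) (s≤s m<n) eq =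
    trans (cong (g a b *_) (prodℚ-zipWith-replaceAt m u v xs ys m<n (ℕP.suc-injective eq))) (sym (*-assoc (g a b) _ _))

  prodℚ-zipWith-nth : ∀ d e m xs ys → m < length xs → length xs ≡ length ys →
    prodℚ (zipWith g xs ys) ≡ prodℚ (zipWith g (removeNth m xs) (removeNth m ys)) * g (nth d xs m) (nth e ys m)
  prodℚ-zipWith-nth d e m xs ys m<n eq = begin
    prodℚ (zipWith g xs ys)
      ≡⟨ cong₂ (λ xs′ ys′ → prodℚ (zipWith g xs′ ys′)) (replaceAt-nth d m xs m<n) (replaceAt-nth e m ys (subst (m <_) eq m<n)) ⟨
    prodℚ (zipWith g (replaceAt m (nth d xs m) xs) (replaceAt m (nth e ys m) ys))
      ≡⟨ prodℚ-zipWith-replaceAt m (nth d xs m) (nth e ys m) xs ys m<n eq ⟩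
    prodℚ (zipWith g (removeNth m xs) (removeNth m ys)) * g (nth d xs m) (nth e ys m) ∎
    where open ≡-Reasoning

prodℚ-zipWith-expand : (g : ℕ → ℕ → ℚ) (l : ℕ) (kb b : List ℕ) (β γ v : ℕ) → l < length kb → length kb ≡ length b →
  prodℚ (zipWith g (expandAt l β γ kb) (insertInto (suc l) v b)) ≡
  prodℚ (zipWith g (removeNth l kb) (removeNth l b)) * (g β (nth 0 b l) * g γ v)
prodℚ-zipWith-expand g zero    (K ∷ kb) (a ∷ b) β γ v _ _ =
  solve 3 (λ s t u → s :* (t :* u) := u :* (s :* t)) refl (g β a) (g γ v) (prodℚ (zipWith g kb b))
  where open ℚ-Solver
prodℚ-zipWith-expand g (suc l) (K ∷ kb) (a ∷ b) β γ v (s≤s l<n) eq =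
  trans (cong (g K a *_) (prodℚ-zipWith-expand g l kb b β γ v l<n (ℕP.suc-injective eq))) (sym (*-assoc (g K a) _ _))

-- Membership in S_p after inserting a variable

∧-implied : ∀ {p} q → (T p → T q) → p ≡ q ∧ p
∧-implied {false} q _   = sym (∧-zeroʳ q)
∧-implied {true}  true  _   = refl
∧-implied {true}  false p⇒q = ⊥-elim (p⇒q _)

<ᵇ-trans : ∀ a b c → T ((a <ᵇ b) ∧ (b <ᵇ c)) → T (a <ᵇ c)
<ᵇ-trans a b c h = let (a<b , b<c) = Equivalence.to T-∧ h in
  ℕP.<⇒<ᵇ (ℕP.<-trans (ℕP.<ᵇ⇒< a b a<b) (ℕP.<ᵇ⇒< b c b<c))

strictIncr-insertInto : ∀ j v b → suc j < length b →
  strictIncr (insertInto (suc j) v b) ≡ strictIncr b ∧ ((nth 0 b j <ᵇ v) ∧ (v <ᵇ nth 0 b (suc j)))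
strictIncr-insertInto zero    v (a ∷ [])         (s≤s ())
strictIncr-insertInto zero    v (a ∷ c ∷ xs)     _ = begin
  (a <ᵇ v) ∧ ((v <ᵇ c) ∧ S)                          ≡⟨ ∧-solve 3 (λ p q s → p ⊕ (q ⊕ s) ⊜ s ⊕ (p ⊕ q)) refl (a <ᵇ v) (v <ᵇ c) S ⟩
  S ∧ ((a <ᵇ v) ∧ (v <ᵇ c))                          ≡⟨ cong (S ∧_) (∧-implied (a <ᵇ c) (<ᵇ-trans a v c)) ⟩
  S ∧ ((a <ᵇ c) ∧ ((a <ᵇ v) ∧ (v <ᵇ c)))             ≡⟨ ∧-solve 3 (λ s r t → s ⊕ (r ⊕ t) ⊜ (r ⊕ s) ⊕ t) refl S (a <ᵇ c) _ ⟩
  ((a <ᵇ c) ∧ S) ∧ ((a <ᵇ v) ∧ (v <ᵇ c))             ∎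
  where
  open ≡-Reasoning
  S = strictIncr (c ∷ xs)
strictIncr-insertInto (suc j) v (a ∷ c ∷ xs) (s≤s j<n) =
  trans (cong ((a <ᵇ c) ∧_) (strictIncr-insertInto j v (c ∷ xs) j<n)) (sym (∧-assoc (a <ᵇ c) _ _))

strictIncr-∷ʳ : ∀ a xs v → strictIncr ((a ∷ xs) ∷ʳ v) ≡ strictIncr (a ∷ xs) ∧ (lastOr a xs <ᵇ v)
strictIncr-∷ʳ a []       v = ∧-identityʳ (a <ᵇ v)
strictIncr-∷ʳ a (c ∷ xs) v = trans (cong ((a <ᵇ c) ∧_) (strictIncr-∷ʳ c xs v)) (sym (∧-assoc (a <ᵇ c) _ _))

cycConds-lasts : ∀ nn → cycConds nn ≡ zipWith _≤ᵇ_ (map (headOr 0) (rotR nn)) (map (lastOr 0) nn)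
cycConds-lasts nn = zipWith-map _≤ᵇ_ (headOr 0) (lastOr 0) (rotR nn) nn

module ReplaceBlock (nn : List (List ℕ)) (m : ℕ) (m<d : m < length nn) (b′ : List ℕ)
               (same-head : headOr 0 b′ ≡ headOr 0 (nth [] nn m)) where

  open ≡-Reasoning

  private
    nn′ = replaceAt m b′ nn
    H = map (headOr 0) (rotR nn)

  heads-rotR : map (headOr 0) (rotR nn′) ≡ H
  heads-rotR = begin
    map (headOr 0) (rotR nn′)    ≡⟨ map-rotR (headOr 0) nn′ ⟩
    rotR (map (headOr 0) nn′)    ≡⟨ cong rotR (map-replaceAt-same (headOr 0) [] m b′ nn m<d same-head) ⟩
    rotR (map (headOr 0) nn)     ≡⟨ map-rotR (headOr 0) nn ⟨
    H                            ∎

  cycConds-replaceAt-inner : lastOr 0 b′ ≡ lastOr 0 (nth [] nn m) → cycConds nn′ ≡ cycConds nn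
  cycConds-replaceAt-inner same-last = begin
    cycConds nn′
      ≡⟨ cycConds-lasts nn′ ⟩
    zipWith _≤ᵇ_ (map (headOr 0) (rotR nn′)) (map (lastOr 0) nn′)
      ≡⟨ cong₂ (zipWith _≤ᵇ_) heads-rotR (map-replaceAt-same (lastOr 0) [] m b′ nn m<d same-last) ⟩
    zipWith _≤ᵇ_ H (map (lastOr 0) nn)
      ≡⟨ cycConds-lasts nn ⟨
    cycConds nn ∎

  and-cycConds-replaceAt : and (cycConds nn′) ≡ (headOr 0 (nth [] (rotR nn) m) ≤ᵇ lastOr 0 b′) ∧ and (removeNth m (cycConds nn))
  and-cycConds-replaceAt = begin
    and (cycConds nn′)
      ≡⟨ cong and (cycConds-lasts nn′) ⟩
    and (zipWith _≤ᵇ_ (map (headOr 0) (rotR nn′)) (map (lastOr 0) nn′))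
      ≡⟨ cong₂ (λ hs ls → and (zipWith _≤ᵇ_ hs ls)) heads-rotR (map-replaceAt (lastOr 0) m b′ nn) ⟩
    and (zipWith _≤ᵇ_ H (replaceAt m (lastOr 0 b′) (map (lastOr 0) nn)))
      ≡⟨ and-zipWith-replaceAt _≤ᵇ_ 0 m (lastOr 0 b′) H (map (lastOr 0) nn) m<H m<L ⟩
    (nth 0 H m ≤ᵇ lastOr 0 b′) ∧ and (removeNth m (zipWith _≤ᵇ_ H (map (lastOr 0) nn)))
      ≡⟨ cong₂ (λ h cs → (h ≤ᵇ lastOr 0 b′) ∧ and (removeNth m cs))
               (nth-map (headOr 0) [] 0 m (rotR nn) m<rotR) (sym (cycConds-lasts nn)) ⟩
    (headOr 0 (nth [] (rotR nn) m) ≤ᵇ lastOr 0 b′) ∧ and (removeNth m (cycConds nn)) ∎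
    where
    m<rotR : m < length (rotR nn)
    m<rotR = subst (m <_) (sym (length-rotR nn)) m<d
    m<H : m < length H
    m<H = subst (m <_) (sym (LP.length-map (headOr 0) (rotR nn))) m<rotR
    m<L : m < length (map (lastOr 0) nn)
    m<L = subst (m <_) (sym (LP.length-map (lastOr 0) nn)) m<d

inS-insert-inner : ∀ nn m j v → m < length nn → suc j < length (nth [] nn m) →
  inS (replaceAt m (insertInto (suc j) v (nth [] nn m)) nn) ≡
  inS nn ∧ ((nth 0 (nth [] nn m) j <ᵇ v) ∧ (v <ᵇ nth 0 (nth [] nn m) (suc j)))
inS-insert-inner nn m j v m<d j<r = begin
  and (map strictIncr (replaceAt m b′ nn)) ∧ and (cycConds (replaceAt m b′ nn))
    ≡⟨ cong₂ _∧_ (and-map-replaceAt strictIncr m b′ nn m<d) (cong and (cycConds-replaceAt-inner (lastOr-insertInto 0 v j b j<r))) ⟩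
  (strictIncr b′ ∧ R) ∧ C
    ≡⟨ cong (λ s → (s ∧ R) ∧ C) (strictIncr-insertInto j v b j<r) ⟩
  ((strictIncr b ∧ between) ∧ R) ∧ C
    ≡⟨ ∧-solve 4 (λ s c r t → ((s ⊕ c) ⊕ r) ⊕ t ⊜ ((s ⊕ r) ⊕ t) ⊕ c) refl (strictIncr b) between R C ⟩
  ((strictIncr b ∧ R) ∧ C) ∧ between
    ≡⟨ cong (λ s → (s ∧ C) ∧ between) (and-map-nth strictIncr [] m nn m<d) ⟨
  inS nn ∧ between ∎
  where
  open ≡-Reasoning
  b = nth [] nn m
  b′ = insertInto (suc j) v b
  between = (nth 0 b j <ᵇ v) ∧ (v <ᵇ nth 0 b (suc j))
  R = and (removeNth m (map strictIncr nn))
  C = and (cycConds nn)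
  open ReplaceBlock nn m m<d b′ (headOr-insertInto 0 v j b (ℕP.<-trans (s≤s z≤n) j<r))

inS-insert-last : ∀ nn m v → m < length nn → 1 ≤ length (nth [] nn m) →
  inS (replaceAt m (nth [] nn m ∷ʳ v) nn) ≡
  inS' m nn ∧ ((lastOr 0 (nth [] nn m) <ᵇ v) ∧ (headOr 0 (nth [] (rotR nn) m) ≤ᵇ v))
inS-insert-last nn m v m<d 1≤r with nth [] nn m in b≡ | 1≤r
... | a ∷ xs | _ = begin
  and (map strictIncr (replaceAt m b′ nn)) ∧ and (cycConds (replaceAt m b′ nn))
    ≡⟨ cong₂ _∧_ (and-map-replaceAt strictIncr m b′ nn m<d) and-cycConds-replaceAt ⟩
  (strictIncr b′ ∧ R) ∧ ((h ≤ᵇ lastOr 0 b′) ∧ R′)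
    ≡⟨ cong₂ (λ s t → (s ∧ R) ∧ ((h ≤ᵇ t) ∧ R′)) (strictIncr-∷ʳ a xs v) (lastOr-∷ʳ 0 v (a ∷ xs)) ⟩
  ((strictIncr (a ∷ xs) ∧ above) ∧ R) ∧ ((h ≤ᵇ v) ∧ R′)
    ≡⟨ ∧-solve 5 (λ s c r g t → ((s ⊕ c) ⊕ r) ⊕ (g ⊕ t) ⊜ ((s ⊕ r) ⊕ t) ⊕ (c ⊕ g)) refl (strictIncr (a ∷ xs)) above R (h ≤ᵇ v) R′ ⟩
  ((strictIncr (a ∷ xs) ∧ R) ∧ R′) ∧ (above ∧ (h ≤ᵇ v))
    ≡⟨ cong (λ s → (s ∧ R′) ∧ (above ∧ (h ≤ᵇ v))) (trans (and-map-nth strictIncr [] m nn m<d) (cong (λ w → strictIncr w ∧ R) b≡)) ⟨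
  inS' m nn ∧ (above ∧ (h ≤ᵇ v)) ∎
  where
  open ≡-Reasoning
  b′ = (a ∷ xs) ∷ʳ v
  above = lastOr a xs <ᵇ v
  h = headOr 0 (nth [] (rotR nn) m)
  R = and (removeNth m (map strictIncr nn))
  R′ = and (removeNth m (cycConds nn))
  open ReplaceBlock nn m m<d b′ (cong (headOr 0) (sym b≡))

seqs-insertInto : ∀ p r l → l ≤ r → (G : List ℕ → ℚ) →
  ∑ (seqs p (suc r)) G ≡ ∑ (seqs p r) (λ s → ∑ (vals p) (λ v → G (insertInto l v s)))
seqs-insertInto p r zero _ G = begin
  ∑ (concatMap (λ v → map (v ∷_) (seqs p r)) (vals p)) G  ≡⟨ ∑-concatMap (λ v → map (v ∷_) (seqs p r)) (vals p) G ⟩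
  ∑ (vals p) (λ v → ∑ (map (v ∷_) (seqs p r)) G)         ≡⟨ ∑-cong (vals p) (λ v → ∑-map (v ∷_) (seqs p r) G) ⟩
  ∑ (vals p) (λ v → ∑ (seqs p r) (λ s → G (v ∷ s)))      ≡⟨ ∑-swap (vals p) (seqs p r) (λ v s → G (v ∷ s)) ⟩
  ∑ (seqs p r) (λ s → ∑ (vals p) (λ v → G (v ∷ s)))      ∎
  where open ≡-Reasoning
seqs-insertInto p (suc r) (suc l) (s≤s l≤r) G = begin
  ∑ (concatMap (λ u → map (u ∷_) (seqs p (suc r))) (vals p)) G
    ≡⟨ ∑-concatMap (λ u → map (u ∷_) (seqs p (suc r))) (vals p) G ⟩
  ∑ (vals p) (λ u → ∑ (map (u ∷_) (seqs p (suc r))) G)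
    ≡⟨ ∑-cong (vals p) (λ u → trans (∑-map (u ∷_) (seqs p (suc r)) G) (seqs-insertInto p r l l≤r (λ s → G (u ∷ s)))) ⟩
  ∑ (vals p) (λ u → ∑ (seqs p r) (λ s → ∑ (vals p) (λ v → G (u ∷ insertInto l v s))))
    ≡⟨ ∑-cong (vals p) (λ u → ∑-map (u ∷_) (seqs p r) _) ⟨
  ∑ (vals p) (λ u → ∑ (map (u ∷_) (seqs p r)) (λ s → ∑ (vals p) (λ v → G (insertInto (suc l) v s))))
    ≡⟨ ∑-concatMap (λ u → map (u ∷_) (seqs p r)) (vals p) _ ⟨
  ∑ (seqs p (suc r)) (λ s → ∑ (vals p) (λ v → G (insertInto (suc l) v s))) ∎
  where open ≡-Reasoning

tuples-replaceAt : ∀ p k m kb′ l (F : List (List ℕ) → ℚ) → m < length k →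
  length kb′ ≡ suc (length (nth [] k m)) → l ≤ length (nth [] k m) →
  ∑ (tuples p (replaceAt m kb′ k)) F ≡ ∑ (tuples p k) (λ nn → ∑ (vals p) (λ v → F (replaceAt m (insertInto l v (nth [] nn m)) nn)))
tuples-replaceAt p (kb ∷ k) zero kb′ l F _ len≡ l≤r rewrite len≡ = begin
  ∑ (concatMap (λ s → map (s ∷_) (tuples p k)) (seqs p (suc (length kb)))) F
    ≡⟨ ∑-concatMap (λ s → map (s ∷_) (tuples p k)) (seqs p (suc (length kb))) F ⟩
  ∑ (seqs p (suc (length kb))) (λ s → ∑ (map (s ∷_) (tuples p k)) F)
    ≡⟨ seqs-insertInto p (length kb) l l≤r _ ⟩
  ∑ (seqs p (length kb)) (λ s → ∑ (vals p) (λ v → ∑ (map (insertInto l v s ∷_) (tuples p k)) F))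
    ≡⟨ ∑-cong (seqs p (length kb)) (λ s → trans (∑-cong (vals p) (λ v → ∑-map (insertInto l v s ∷_) (tuples p k) F))
                                              (∑-swap (vals p) (tuples p k) (λ v nn → F (insertInto l v s ∷ nn)))) ⟩
  ∑ (seqs p (length kb)) (λ s → ∑ (tuples p k) (λ nn → ∑ (vals p) (λ v → F (insertInto l v s ∷ nn))))
    ≡⟨ ∑-cong (seqs p (length kb)) (λ s → ∑-map (s ∷_) (tuples p k) _) ⟨
  ∑ (seqs p (length kb)) (λ s → ∑ (map (s ∷_) (tuples p k))
                                  (λ nn → ∑ (vals p) (λ v → F (replaceAt zero (insertInto l v (nth [] nn zero)) nn))))
    ≡⟨ ∑-concatMap (λ s → map (s ∷_) (tuples p k)) (seqs p (length kb)) _ ⟨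
  ∑ (tuples p (kb ∷ k)) (λ nn → ∑ (vals p) (λ v → F (replaceAt zero (insertInto l v (nth [] nn zero)) nn))) ∎
  where open ≡-Reasoning
tuples-replaceAt p (kb ∷ k) (suc m) kb′ l F (s≤s m<d) len≡ l≤r = begin
  ∑ (concatMap (λ s → map (s ∷_) (tuples p (replaceAt m kb′ k))) (seqs p (length kb))) F
    ≡⟨ ∑-concatMap (λ s → map (s ∷_) (tuples p (replaceAt m kb′ k))) (seqs p (length kb)) F ⟩
  ∑ (seqs p (length kb)) (λ s → ∑ (map (s ∷_) (tuples p (replaceAt m kb′ k))) F)
    ≡⟨ ∑-cong (seqs p (length kb)) (λ s → trans (∑-map (s ∷_) (tuples p (replaceAt m kb′ k)) F)
                                          (trans (tuples-replaceAt p k m kb′ l (λ nn → F (s ∷ nn)) m<d len≡ l≤r)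
                                                 (sym (∑-map (s ∷_) (tuples p k) _)))) ⟩
  ∑ (seqs p (length kb)) (λ s → ∑ (map (s ∷_) (tuples p k))
                                  (λ nn → ∑ (vals p) (λ v → F (replaceAt (suc m) (insertInto l v (nth [] nn (suc m))) nn))))
    ≡⟨ ∑-concatMap (λ s → map (s ∷_) (tuples p k)) (seqs p (length kb)) _ ⟨
  ∑ (tuples p (kb ∷ k)) (λ nn → ∑ (vals p) (λ v → F (replaceAt (suc m) (insertInto l v (nth [] nn (suc m))) nn))) ∎
  where open ≡-Reasoning

seqs-length : ∀ p r → All (λ s → length s ≡ r) (seqs p r)
seqs-length p zero    = refl ∷ []
seqs-length p (suc r) = Allₚ.concat⁺ (Allₚ.map⁺ (All.universal (λ v → Allₚ.map⁺ (All.map (cong suc) (seqs-length p r))) (vals p)))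

tuples-shape : ∀ p k → All (λ nn → map length nn ≡ map length k) (tuples p k)
tuples-shape p []       = refl ∷ []
tuples-shape p (kb ∷ k) = Allₚ.concat⁺ (Allₚ.map⁺
  (All.map (λ len≡ → Allₚ.map⁺ (All.map (cong₂ _∷_ len≡) (tuples-shape p k))) (seqs-length p (length kb))))

module Shape {nn k : List (List ℕ)} (shape : map length nn ≡ map length k) where

  length≡ : length k ≡ length nn
  length≡ = trans (sym (LP.length-map length k)) (trans (cong length (sym shape)) (LP.length-map length nn))

  block-length≡ : ∀ m → m < length k → length (nth [] k m) ≡ length (nth [] nn m)
  block-length≡ m m<d = begin
    length (nth [] k m)       ≡⟨ nth-map length [] 0 m k m<d ⟨
    nth 0 (map length k) m    ≡⟨ cong (λ ls → nth 0 ls m) shape ⟨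
    nth 0 (map length nn) m   ≡⟨ nth-map length [] 0 m nn (subst (m <_) length≡ m<d) ⟩
    length (nth [] nn m)      ∎
    where open ≡-Reasoning

entryWeight : ℕ → ℕ → ℚ
entryWeight kk n = recip (n ^ kk)

blockWeight : List ℕ → List ℕ → ℚ
blockWeight kb b = prodℚ (zipWith entryWeight kb b)

weight-expand : ∀ k nn m l v → map length nn ≡ map length k → m < length k → l < length (nth [] k m) →
  All (1 ≤_) (nth [] k m) → nth 0 (nth [] nn m) l < v →
  ∑ (shuffleTerms (nth 0 (nth [] k m) l))
    (λ (c , β , γ) → c * weight (replaceAt m (expandAt l β γ (nth [] k m)) k) (replaceAt m (insertInto (suc l) v (nth [] nn m)) nn))
  ≡ weight k nn * corr (nth 0 (nth [] nn m) l) (nth 0 (nth [] k m) l) v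
weight-expand k nn m l v shape m<d l<r kb-pos a<v = begin
  ∑ (shuffleTerms K) (λ (c , β , γ) → c * weight (replaceAt m (expandAt l β γ kb) k) (replaceAt m b′ nn))
    ≡⟨ ∑-cong (shuffleTerms K) factor ⟩
  ∑ (shuffleTerms K) (λ t → Rest * Q * termWeight a v t)
    ≡⟨ ∑-*ˡ (shuffleTerms K) (Rest * Q) (termWeight a v) ⟩
  Rest * Q * ∑ (shuffleTerms K) (termWeight a v)
    ≡⟨ cong (Rest * Q *_) (∑-shuffleTerms a v K a<v (All-nth 0 kb-pos l l<r)) ⟩
  Rest * Q * (recip (a ^ K) * corr a K v)
    ≡⟨ solve 4 (λ s q e c → s :* q :* (e :* c) := s :* (q :* e) :* c) refl Rest Q (recip (a ^ K)) (corr a K v) ⟩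
  Rest * (Q * entryWeight K a) * corr a K v
    ≡⟨ cong (λ w → Rest * w * corr a K v) (prodℚ-zipWith-nth entryWeight 0 0 l kb b l<r r≡) ⟨
  Rest * blockWeight kb b * corr a K v
    ≡⟨ cong (_* corr a K v) (prodℚ-zipWith-nth blockWeight [] [] m k nn m<d length≡) ⟨
  weight k nn * corr a K v ∎
  where
  open ≡-Reasoning
  open ℚ-Solver
  open Shape shape
  kb = nth [] k m
  b = nth [] nn m
  a = nth 0 b l
  K = nth 0 kb l
  b′ = insertInto (suc l) v b
  r≡ = block-length≡ m m<d
  Rest Q : ℚ
  Rest = prodℚ (zipWith blockWeight (removeNth m k) (removeNth m nn))
  Q = prodℚ (zipWith entryWeight (removeNth l kb) (removeNth l b))
  factor : ∀ ((c , β , γ) : ℚ × ℕ × ℕ) →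
    c * weight (replaceAt m (expandAt l β γ kb) k) (replaceAt m b′ nn) ≡ Rest * Q * termWeight a v (c , β , γ)
  factor (c , β , γ) = begin
    c * weight (replaceAt m (expandAt l β γ kb) k) (replaceAt m b′ nn)
      ≡⟨ cong (c *_) (prodℚ-zipWith-replaceAt blockWeight m (expandAt l β γ kb) b′ k nn m<d length≡) ⟩
    c * (Rest * blockWeight (expandAt l β γ kb) b′)
      ≡⟨ cong (λ w → c * (Rest * w)) (prodℚ-zipWith-expand entryWeight l kb b β γ v l<r r≡) ⟩
    c * (Rest * (Q * (entryWeight β a * entryWeight γ v)))
      ≡⟨ solve 5 (λ c s q e f → c :* (s :* (q :* (e :* f))) := s :* q :* (c :* (e :* f)))
                 refl c Rest Q (entryWeight β a) (entryWeight γ v) ⟩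
    Rest * Q * termWeight a v (c , β , γ) ∎

length-expandAt : ∀ l β γ kb → l < length kb → length (expandAt l β γ kb) ≡ suc (length kb)
length-expandAt zero    β γ (K ∷ kb) _         = refl
length-expandAt (suc l) β γ (K ∷ kb) (s≤s l<r) = cong suc (length-expandAt l β γ kb l<r)

map-toIndices-zs : ∀ {k} → All (All (1 ≤_)) k → map toIndices (map zs k) ≡ k
map-toIndices-zs []                = refl
map-toIndices-zs (kb-pos ∷ k-pos)  = cong₂ _∷_ (toIndices-zs kb-pos) (map-toIndices-zs k-pos)


-- Expanding y ~ш w_i inside Z^cyc

module Expansion (p : ℕ) (k : List (List ℕ)) (m : ℕ) (m<d : m < length k) (k-pos : All (All (1 ≤_)) k) where

  open ≡-Reasoning

  kb : List ℕ
  kb = nth [] k m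

  r : ℕ
  r = length kb

  kb-pos : All (1 ≤_) kb
  kb-pos = All-nth [] k-pos m m<d

  -- expanded l β γ indexes the term of y ~ш z_(k_(m,l)) with the word z_β z_γ at position l;
  -- inserted l v nn is nn with a new variable v right after n_(m,l).
  expanded : ℕ → ℕ → ℕ → List (List ℕ)
  expanded l β γ = replaceAt m (expandAt l β γ kb) k

  inserted : ℕ → ℕ → List (List ℕ) → List (List ℕ)
  inserted l v nn = replaceAt m (insertInto (suc l) v (nth [] nn m)) nn

  Zcyc-ytilde : Zcyc (insertAt m (map zs k) (ytilde kb)) p ≡
    ∑ (upTo r) (λ l → ∑ (shuffleTerms (nth 0 kb l)) (λ (c , β , γ) → c * ζcyc (expanded l β γ) p))
  Zcyc-ytilde = begin
    ∑ (insertAt m (map zs k) (ytilde kb)) G                         ≡⟨ ∑-map _ (ytilde kb) G ⟩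
    ∑ (ytilde kb) (λ (c , w) → c * ζ (replaceAt m w (map zs k)))    ≡⟨ ∑-concatMap term (upTo r) _ ⟩
    ∑ (upTo r) (λ l → ∑ (term l) (λ (c , w) → c * ζ (replaceAt m w (map zs k))))
                                                                    ≡⟨ ∑-cong (upTo r) per-position ⟩
    ∑ (upTo r) (λ l → ∑ (shuffleTerms (nth 0 kb l)) (λ (c , β , γ) → c * ζcyc (expanded l β γ) p)) ∎
    where
    ζ : List Word → ℚ
    ζ ws = ζcyc (map toIndices ws) p
    G : ℚ × List Word → ℚ
    G (c , ws) = c * ζ ws
    around : ℕ → Word → Word
    around l w = zs (take l kb) ++ (w ++ zs (drop (suc l) kb))
    term : ℕ → Poly
    term l = map (λ (c , w) → (c , around l w)) (ytz (nth 0 kb l))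
    per-position : ∀ l → ∑ (term l) (λ (c , w) → c * ζ (replaceAt m w (map zs k))) ≡
                         ∑ (shuffleTerms (nth 0 kb l)) (λ (c , β , γ) → c * ζcyc (expanded l β γ) p)
    per-position l = begin
      ∑ (term l) (λ (c , w) → c * ζ (replaceAt m w (map zs k)))
        ≡⟨ ∑-map _ (ytz (nth 0 kb l)) _ ⟩
      ∑ (ytz (nth 0 kb l)) (λ (c , w) → c * ζ (replaceAt m (around l w) (map zs k)))
        ≡⟨ cong (λ ts → ∑ ts (λ (c , w) → c * ζ (replaceAt m (around l w) (map zs k)))) (ytz-shuffleTerms (nth 0 kb l)) ⟩
      ∑ (map termWord (shuffleTerms (nth 0 kb l))) (λ (c , w) → c * ζ (replaceAt m (around l w) (map zs k)))
        ≡⟨ ∑-map termWord (shuffleTerms (nth 0 kb l)) _ ⟩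
      ∑ (shuffleTerms (nth 0 kb l)) (λ (c , β , γ) → c * ζ (replaceAt m (around l (zs (β ∷ γ ∷ []))) (map zs k)))
        ≡⟨ ∑-congᴬ (All.map (λ {t} (β≥1 , γ≥1) → cong (λ ns → proj₁ t * ζcyc ns p) (indices t β≥1 γ≥1))
                            (shuffleTerms-positive (nth 0 kb l))) ⟩
      ∑ (shuffleTerms (nth 0 kb l)) (λ (c , β , γ) → c * ζcyc (expanded l β γ) p) ∎
      where
      indices : ∀ ((_ , β , γ) : ℚ × ℕ × ℕ) → 1 ≤ β → 1 ≤ γ →
        map toIndices (replaceAt m (around l (zs (β ∷ γ ∷ []))) (map zs k)) ≡ expanded l β γ
      indices (_ , β , γ) β≥1 γ≥1 = trans (map-replaceAt toIndices m _ (map zs k))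
        (cong₂ (replaceAt m) (toIndices-expandAt l β≥1 γ≥1 kb-pos) (map-toIndices-zs k-pos))

  ζcyc-expanded : ∀ l β γ → l < r → ζcyc (expanded l β γ) p ≡
    ∑ (tuples p k) (λ nn → ∑ (vals p) (λ v →
      if inS (inserted l v nn) then weight (expanded l β γ) (inserted l v nn) else 0ℚ))
  ζcyc-expanded l β γ l<r =
    trans (∑-filter inS (tuples p (expanded l β γ)) (weight (expanded l β γ)))
          (tuples-replaceAt p k m (expandAt l β γ kb) (suc l) _ m<d (length-expandAt l β γ kb l<r) l<r)

  contribution : ℕ → ℕ → List (List ℕ) → ℚ
  contribution l v nn = ∑ (shuffleTerms (nth 0 kb l)) (λ (c , β , γ) → c * weight (expanded l β γ) (inserted l v nn))

  regroup : ∑ (upTo r) (λ l → ∑ (shuffleTerms (nth 0 kb l)) (λ (c , β , γ) → c * ζcyc (expanded l β γ) p)) ≡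
    ∑ (tuples p k) (λ nn → ∑ (vals p) (λ v → ∑ (upTo r) (λ l → if inS (inserted l v nn) then contribution l v nn else 0ℚ)))
  regroup = begin
    ∑ (upTo r) (λ l → ∑ (shuffleTerms (nth 0 kb l)) (λ (c , β , γ) → c * ζcyc (expanded l β γ) p))
      ≡⟨ ∑-congᴬ (Allₚ.applyUpTo⁺₁ id r (λ l<r → expand-ζ _ l<r)) ⟩
    ∑ (upTo r) (λ l → ∑ 𝒯 (λ nn → ∑ 𝒱 (λ v → if inS (inserted l v nn) then contribution l v nn else 0ℚ)))
      ≡⟨ ∑-swap (upTo r) 𝒯 _ ⟩
    ∑ 𝒯 (λ nn → ∑ (upTo r) (λ l → ∑ 𝒱 (λ v → if inS (inserted l v nn) then contribution l v nn else 0ℚ)))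
      ≡⟨ ∑-cong 𝒯 (λ nn → ∑-swap (upTo r) 𝒱 _) ⟩
    ∑ 𝒯 (λ nn → ∑ 𝒱 (λ v → ∑ (upTo r) (λ l → if inS (inserted l v nn) then contribution l v nn else 0ℚ))) ∎
    where
    𝒯 = tuples p k
    𝒱 = vals p
    expand-ζ : ∀ l → l < r →
      ∑ (shuffleTerms (nth 0 kb l)) (λ (c , β , γ) → c * ζcyc (expanded l β γ) p) ≡
      ∑ 𝒯 (λ nn → ∑ 𝒱 (λ v → if inS (inserted l v nn) then contribution l v nn else 0ℚ))
    expand-ζ l l<r = begin
      ∑ S (λ (c , β , γ) → c * ζcyc (expanded l β γ) p)
        ≡⟨ ∑-cong S (λ (c , β , γ) → cong (c *_) (ζcyc-expanded l β γ l<r)) ⟩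
      ∑ S (λ (c , β , γ) → c * ∑ 𝒯 (λ nn → ∑ 𝒱 (λ v → summand c β γ v nn)))
        ≡⟨ ∑-cong S (λ (c , β , γ) → trans (sym (∑-*ˡ 𝒯 c _)) (∑-cong 𝒯 (λ nn → sym (∑-*ˡ 𝒱 c _)))) ⟩
      ∑ S (λ (c , β , γ) → ∑ 𝒯 (λ nn → ∑ 𝒱 (λ v → c * summand c β γ v nn)))
        ≡⟨ trans (∑-swap S 𝒯 _) (∑-cong 𝒯 (λ nn → ∑-swap S 𝒱 _)) ⟩
      ∑ 𝒯 (λ nn → ∑ 𝒱 (λ v → ∑ S (λ (c , β , γ) → c * summand c β γ v nn)))
        ≡⟨ ∑-cong 𝒯 (λ nn → ∑-cong 𝒱 (λ v → pull-if v nn)) ⟩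
      ∑ 𝒯 (λ nn → ∑ 𝒱 (λ v → if inS (inserted l v nn) then contribution l v nn else 0ℚ)) ∎
      where
      S = shuffleTerms (nth 0 kb l)
      summand : ℚ → ℕ → ℕ → ℕ → List (List ℕ) → ℚ
      summand c β γ v nn = if inS (inserted l v nn) then weight (expanded l β γ) (inserted l v nn) else 0ℚ
      pull-if : ∀ v nn → ∑ S (λ (c , β , γ) → c * summand c β γ v nn) ≡ (if inS (inserted l v nn) then contribution l v nn else 0ℚ)
      pull-if v nn = trans (∑-cong S (λ (c , β , γ) → *-if (inS (inserted l v nn)) c _)) (∑-if (inS (inserted l v nn)) S _)

  between : ℕ → ℕ → List (List ℕ) → Bool
  between j v nn = (nth 0 (nth [] nn m) j <ᵇ v) ∧ (v <ᵇ nth 0 (nth [] nn m) (suc j))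

  beyond : ℕ → List (List ℕ) → Bool
  beyond v nn = (lastOr 0 (nth [] nn m) <ᵇ v) ∧ (headOr 0 (nth [] (rotR nn) m) ≤ᵇ v)

  innerTerm : ℕ → ℕ → List (List ℕ) → ℚ
  innerTerm j v nn = if inS nn ∧ between j v nn then weight k nn * corr (nth 0 (nth [] nn m) j) (nth 0 kb j) v else 0ℚ

  lastTerm : ℕ → List (List ℕ) → ℚ
  lastTerm v nn = if inS' m nn ∧ beyond v nn then weight k nn * corr (lastOr 0 (nth [] nn m)) (lastOr 0 kb) v else 0ℚ

  rhs-as-sum : rhs k m p ≡ ∑ (tuples p k) (λ nn → ∑ (vals p) (λ v → ∑ (upTo (r ∸ 1)) (λ j → innerTerm j v nn) +ℚ lastTerm v nn))
  rhs-as-sum = begin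
    sumS p k inner +ℚ sumS' p m k last
      ≡⟨ cong₂ _+ℚ_ (∑-filter inS 𝒯 inner) (∑-filter (inS' m) 𝒯 last) ⟩
    ∑ 𝒯 (λ nn → if inS nn then inner nn else 0ℚ) +ℚ ∑ 𝒯 (λ nn → if inS' m nn then last nn else 0ℚ)
      ≡⟨ cong₂ _+ℚ_ (∑-cong 𝒯 inner-as-sum) (∑-cong 𝒯 last-as-sum) ⟩
    ∑ 𝒯 (λ nn → ∑ 𝒱 (λ v → ∑ (upTo (r ∸ 1)) (λ j → innerTerm j v nn))) +ℚ ∑ 𝒯 (λ nn → ∑ 𝒱 (λ v → lastTerm v nn))
      ≡⟨ ∑-+ 𝒯 _ _ ⟨
    ∑ 𝒯 (λ nn → ∑ 𝒱 (λ v → ∑ (upTo (r ∸ 1)) (λ j → innerTerm j v nn)) +ℚ ∑ 𝒱 (λ v → lastTerm v nn))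
      ≡⟨ ∑-cong 𝒯 (λ nn → sym (∑-+ 𝒱 _ _)) ⟩
    ∑ 𝒯 (λ nn → ∑ 𝒱 (λ v → ∑ (upTo (r ∸ 1)) (λ j → innerTerm j v nn) +ℚ lastTerm v nn)) ∎
    where
    𝒯 = tuples p k
    𝒱 = vals p
    innerWeight : ℕ → ℕ → List (List ℕ) → ℚ
    innerWeight j v nn = weight k nn * corr (nth 0 (nth [] nn m) j) (nth 0 kb j) v
    inner : List (List ℕ) → ℚ
    inner nn = sumℚ (map (λ j → sumN p (λ v → between j v nn) (λ v → innerWeight j v nn)) (upTo (r ∸ 1)))
    last : List (List ℕ) → ℚ
    last nn = sumN p (λ v → beyond v nn) (λ v → weight k nn * corr (lastOr 0 (nth [] nn m)) (lastOr 0 kb) v)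
    inner-as-sum : ∀ nn → (if inS nn then inner nn else 0ℚ) ≡ ∑ 𝒱 (λ v → ∑ (upTo (r ∸ 1)) (λ j → innerTerm j v nn))
    inner-as-sum nn = begin
      (if inS nn then inner nn else 0ℚ)
        ≡⟨ cong (λ q → if inS nn then q else 0ℚ) (∑-cong (upTo (r ∸ 1)) (λ j → ∑-filter (λ v → between j v nn) 𝒱 _)) ⟩
      (if inS nn then ∑ (upTo (r ∸ 1)) (λ j → ∑ 𝒱 (λ v → if between j v nn then innerWeight j v nn else 0ℚ)) else 0ℚ)
        ≡⟨ ∑-if (inS nn) (upTo (r ∸ 1)) _ ⟨
      ∑ (upTo (r ∸ 1)) (λ j → if inS nn then ∑ 𝒱 (λ v → if between j v nn then innerWeight j v nn else 0ℚ) else 0ℚ)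
        ≡⟨ ∑-cong (upTo (r ∸ 1)) (λ j → trans (sym (∑-if (inS nn) 𝒱 _)) (∑-cong 𝒱 (λ v → if-∧ (inS nn) (between j v nn) _))) ⟩
      ∑ (upTo (r ∸ 1)) (λ j → ∑ 𝒱 (λ v → innerTerm j v nn))
        ≡⟨ ∑-swap (upTo (r ∸ 1)) 𝒱 _ ⟩
      ∑ 𝒱 (λ v → ∑ (upTo (r ∸ 1)) (λ j → innerTerm j v nn)) ∎
    last-as-sum : ∀ nn → (if inS' m nn then last nn else 0ℚ) ≡ ∑ 𝒱 (λ v → lastTerm v nn)
    last-as-sum nn = trans (cong (λ q → if inS' m nn then q else 0ℚ) (∑-filter (λ v → beyond v nn) 𝒱 _))
      (trans (sym (∑-if (inS' m nn) 𝒱 _)) (∑-cong 𝒱 (λ v → if-∧ (inS' m nn) (beyond v nn) _)))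

  module _ (1≤r : 1 ≤ r) {nn : List (List ℕ)} (shape : map length nn ≡ map length k) (v : ℕ) where

    open Shape shape

    private
      b : List ℕ
      b = nth [] nn m
      m<|nn| : m < length nn
      m<|nn| = subst (m <_) length≡ m<d
      |b|≡r : length b ≡ r
      |b|≡r = sym (block-length≡ m m<d)
      suc[r∸1]≡r : suc (r ∸ 1) ≡ r
      suc[r∸1]≡r = ℕP.m+[n∸m]≡n 1≤r
      T-∧ʳ : ∀ {s c} → T (s ∧ c) → T c
      T-∧ʳ {true} t = t

    inner-position : ∀ j → j < r ∸ 1 →
      (if inS (inserted j v nn) then contribution j v nn else 0ℚ) ≡ innerTerm j v nn
    inner-position j j<r∸1 = trans (cong (λ c → if c then contribution j v nn else 0ℚ) (inS-insert-inner nn m j v m<|nn| j+1<|b|))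
      (if-cong (inS nn ∧ between j v nn) (λ t →
        weight-expand k nn m j v shape m<d (ℕP.<-trans (ℕP.n<1+n j) j+1<r) kb-pos
          (ℕP.<ᵇ⇒< _ v (proj₁ (Equivalence.to T-∧ (T-∧ʳ {inS nn} t))))))
      where
      j+1<r : suc j < r
      j+1<r = subst (suc j <_) suc[r∸1]≡r (s≤s j<r∸1)
      j+1<|b| : suc j < length b
      j+1<|b| = subst (suc j <_) (sym |b|≡r) j+1<r

    last-position : (if inS (inserted (r ∸ 1) v nn) then contribution (r ∸ 1) v nn else 0ℚ) ≡ lastTerm v nn
    last-position = trans (cong (λ c → if c then contribution (r ∸ 1) v nn else 0ℚ) inS-appended)
      (if-cong (inS' m nn ∧ beyond v nn) (λ t → trans
        (weight-expand k nn m (r ∸ 1) v shape m<d r∸1<r kb-pos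
          (subst (_< v) (sym last-b) (ℕP.<ᵇ⇒< _ v (proj₁ (Equivalence.to T-∧ (T-∧ʳ {inS' m nn} t))))))
        (cong₂ (λ a K → weight k nn * corr a K v) last-b (nth-lastIndex 0 kb 1≤r))))
      where
      1≤|b| : 1 ≤ length b
      1≤|b| = subst (1 ≤_) (sym |b|≡r) 1≤r
      r∸1<r : r ∸ 1 < r
      r∸1<r = subst (r ∸ 1 <_) suc[r∸1]≡r (ℕP.n<1+n (r ∸ 1))
      last-b : nth 0 b (r ∸ 1) ≡ lastOr 0 b
      last-b = trans (cong (λ i → nth 0 b (i ∸ 1)) (sym |b|≡r)) (nth-lastIndex 0 b 1≤|b|)
      inS-appended : inS (inserted (r ∸ 1) v nn) ≡ inS' m nn ∧ beyond v nn
      inS-appended = trans (cong (λ i → inS (replaceAt m (insertInto i v b) nn)) (trans suc[r∸1]≡r (sym |b|≡r)))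
        (trans (cong (λ b′ → inS (replaceAt m b′ nn)) (insertInto-length v b)) (inS-insert-last nn m v m<|nn| 1≤|b|))

    positions : ∑ (upTo r) (λ l → if inS (inserted l v nn) then contribution l v nn else 0ℚ) ≡
                ∑ (upTo (r ∸ 1)) (λ j → innerTerm j v nn) +ℚ lastTerm v nn
    positions = begin
      ∑ (upTo r) Z
        ≡⟨ cong (λ ls → ∑ ls Z) (sym (trans (LP.upTo-∷ʳ (r ∸ 1)) (cong upTo suc[r∸1]≡r))) ⟩
      ∑ (upTo (r ∸ 1) ++ (r ∸ 1) ∷ []) Z
        ≡⟨ ∑-++ (upTo (r ∸ 1)) ((r ∸ 1) ∷ []) Z ⟩
      ∑ (upTo (r ∸ 1)) Z +ℚ (Z (r ∸ 1) +ℚ 0ℚ)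
        ≡⟨ cong₂ _+ℚ_ (∑-congᴬ (Allₚ.applyUpTo⁺₁ id (r ∸ 1) (λ {j} j< → inner-position j j<)))
                      (trans (+-identityʳ _) last-position) ⟩
      ∑ (upTo (r ∸ 1)) (λ j → innerTerm j v nn) +ℚ lastTerm v nn ∎
      where
      Z : ℕ → ℚ
      Z l = if inS (inserted l v nn) then contribution l v nn else 0ℚ

  Zcyc-ytilde≡rhs : 1 ≤ r → Zcyc (insertAt m (map zs k) (ytilde kb)) p ≡ rhs k m p
  Zcyc-ytilde≡rhs 1≤r = begin
    Zcyc (insertAt m (map zs k) (ytilde kb)) p
      ≡⟨ trans Zcyc-ytilde regroup ⟩
    ∑ (tuples p k) (λ nn → ∑ (vals p) (λ v → ∑ (upTo r) (λ l → if inS (inserted l v nn) then contribution l v nn else 0ℚ)))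
      ≡⟨ ∑-congᴬ (All.map (λ shape → ∑-cong (vals p) (positions 1≤r shape)) (tuples-shape p k)) ⟩
    ∑ (tuples p k) (λ nn → ∑ (vals p) (λ v → ∑ (upTo (r ∸ 1)) (λ j → innerTerm j v nn) +ℚ lastTerm v nn))
      ≡⟨ rhs-as-sum ⟨
    rhs k m p ∎

≡⇒≈𝓐 : {f g : 𝓐rep} → (∀ p → f p ≡ g p) → f ≈𝓐 g
≡⇒≈𝓐 {f} {g} f≗g = 0 , λ p _ _ →
  subst (λ q → p ∣ ℤ.∣ ↥ q ∣) (sym (trans (cong (_- g p) (f≗g p)) (+-inverseʳ (g p)))) (p ∣0)

lemma2p1 : (k : List (List ℕ)) →
    1 ≤ length k →
    All (λ kb → 1 ≤ length kb) k →
    All (All (λ kk → 1 ≤ kk)) k →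
    (i : ℕ) → 1 ≤ i → i ≤ length k →
    Zcyc (insertAt (i ∸ 1) (map zs k) (ytilde (nth [] k (i ∸ 1)))) ≈𝓐 rhs k (i ∸ 1)
lemma2p1 k _ blocks-nonempty k-pos (suc i) _ i<d =
  ≡⇒≈𝓐 (λ p → Expansion.Zcyc-ytilde≡rhs p k i i<d k-pos (All-nth [] blocks-nonempty i i<d))
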